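{- Let $p$ be a prime, $q=p^r$ with $r\geq1$, and $L:\mathbb{F}_q\to\mathbb{F}_q$ a linear function. Let $k>1$ be an integer and $D=p^{\lfloor\log_p(k)\rfloor+1}$. For $\beta\in\mathbb{F}_q$ let $\mathbbm{p}^{(q)}_{n,k}(\beta;L)=\frac{1}{q^n}\left|\{\mathbf{x}\in\mathbb{F}_q^n: L(\boldsymbol{e}_k(\mathbf{x}))=\beta\}\right|$ and $\mathrm{G}^{(q)}_{n,k}(L;X)=\sum_{\beta\in\mathbb{F}_q}\mathbbm{p}^{(q)}_{n,k}(\beta;L)X^\beta$. Then \[ \lim_{n\to\infty}\mathrm{G}^{(q)}_{n,k}(L;X)=\frac{1}{D^{q-1}}\sum_{b_{q-1}=0}^{D-1}\cdots\sum_{b_1=0}^{D-1}X^{L\left(\Lambda_{\mathbb{F}_q^\times}(k,b_1,\ldots,b_{q-1})\right)}. \]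
   Context: $\boldsymbol{e}_k(\mathbf{x})$ is the elementary symmetric polynomial of degree $k$ evaluated at $\mathbf{x}\in\mathbb{F}_q^n$. $X$ is a formal symbol: expressions $\sum_{\beta\in\mathbb{F}_q}c_\beta X^\beta$ are elements of the group algebra of $(\mathbb{F}_q,+)$ over $\mathbb{R}$, and the limit is taken coefficientwise (so the claim says each $\mathbbm{p}^{(q)}_{n,k}(\beta;L)$ converges to the coefficient of $X^\beta$ on the right, after collecting equal exponents). Fix an enumeration $\mathbb{F}_q^\times=\{\alpha_1,\ldots,\alpha_{q-1}\}$; $\Lambda_{\mathbb{F}_q^\times}(k,b_1,\ldots,b_{q-1})$ is the value of $\boldsymbol{e}_k$ at a vector in which each $\alpha_i$ appears exactly $b_i$ times (other entries $0$). -}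

module Defs where

open import Level using (0ℓ)
open import Algebra.Bundles using (CommutativeRing)
open import Data.Nat as ℕ using (ℕ; zero; suc)
open import Data.Fin using (Fin; toℕ)
open import Data.List using (List; []; _∷_; [_]; map; concat; concatMap; filter; length; replicate; lookup; allFin)
open import Data.Vec.Functional as VF using (Vector)
open import Data.Integer using (+_)
open import Data.Rational as ℚ using (ℚ)
open import Data.Product using (∃)
open import Relation.Nullary using (¬_; ¬?)
open import Relation.Binary using (Decidable)
open import Relation.Binary.PropositionalEquality using (_≡_)

record FiniteField : Set₁ where
  field
    commRing : CommutativeRing 0ℓ 0ℓ
  open CommutativeRing commRing public
  field
    _≟_     : Decidable _≈_
    1≉0     : ¬ (1# ≈ 0#)
    inverse : ∀ x → ¬ (x ≈ 0#) → ∃ λ y → (x * y) ≈ 1#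
    size    : ℕ
    enum    : Fin size → Carrier
    enum-injective  : ∀ i j → enum i ≈ enum j → i ≡ j
    enum-surjective : ∀ x → ∃ λ i → enum i ≈ x

module _ (F : FiniteField) where
  open FiniteField F

  -- F_p-linear (equivalently, additive) maps F → F, respecting ≈.
  record IsLinear (L : Carrier → Carrier) : Set where
    field
      cong     : ∀ {x y} → x ≈ y → L x ≈ L y
      additive : ∀ x y → L (x + y) ≈ (L x + L y)

  esym : ℕ → List Carrier → Carrier
  esym zero    _        = 1#
  esym (suc k) []       = 0#
  esym (suc k) (x ∷ xs) = esym (suc k) xs + (x * esym k xs)

  nonzeros : List Carrier
  nonzeros = filter (λ x → ¬? (x ≟ 0#)) (map enum (allFin size))

  Λ : ℕ → (Fin (length nonzeros) → ℕ) → Carrier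
  Λ k b = esym k (concat (map (λ i → replicate (b i) (lookup nonzeros i))
                              (allFin (length nonzeros))))

allFuns : (n m : ℕ) → List (Vector (Fin m) n)
allFuns zero    m = [ (λ ()) ]
allFuns (suc n) m = concatMap (λ i → map (i VF.∷_) (allFuns n m)) (allFin m)

-- a / d as a rational (d = 0 never occurs in use; mapped to 0)
frac : ℕ → ℕ → ℚ
frac a zero    = ℚ.0ℚ
frac a (suc d) = (+ a) ℚ./ suc d

module _ (F : FiniteField) where
  open FiniteField F

  prob : (L : Carrier → Carrier) → (n k : ℕ) → Carrier → ℚ
  prob L n k β =
    frac (length (filter (λ v → L (esym F k (VF.toList (λ j → enum (v j)))) ≟ β)
                         (allFuns n size)))
         (size ℕ.^ n)

  -- coefficient of X^β in  D^{-(q-1)} Σ_{b ∈ {0..D-1}^{q-1}} X^{L(Λ(k,b))}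
  limitCoeff : (L : Carrier → Carrier) → (k D : ℕ) → Carrier → ℚ
  limitCoeff L k D β =
    frac (length (filter (λ b → L (Λ F k (λ i → toℕ (b i))) ≟ β)
                         (allFuns (length (nonzeros F)) D)))
         (D ℕ.^ (size ℕ.∸ 1))

-- For k < D = p^s, the elementary symmetric polynomial e_k does not see D equal entries:
-- e_k(a, …, a, y) = ∑_i C(D, i) a^i e_{k−i}(y), and C(D, i) vanishes in characteristic p for
-- 0 < i < D. Hence e_k of a word x ∈ F^n only depends on its class, the vector of multiplicities
-- modulo D of the nonzero elements in x, and equals Λ(k, class). Reading a word letter by letter
-- is a random walk on the group (ℤ/D)^(q−1) of classes in which every class reaches every other
-- in T steps, so a Doeblin minorization shows that the number of words of length n in each class
-- is q^n / D^(q−1) up to an error decaying geometrically in n. The class of a uniformly random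
-- word thus tends to be uniform, and summing over the classes with L(Λ(k, class)) = β gives the
-- limit.

module Submission where

open import Defs
open import Data.Nat using (ℕ)
import Algebra.Bundles

module Convolution {c ℓ} (R : Algebra.Bundles.Semiring c ℓ) where
  open import Data.Nat using (ℕ; zero; suc; _≤_; z≤n; s≤s)
  open import Function using (_∘_)
  open Algebra.Bundles.Semiring R
  open import Algebra.Properties.CommutativeSemigroup +-commutativeSemigroup
    using () renaming (interchange to +-interchange)

  conv : ℕ → (ℕ → Carrier) → (ℕ → Carrier) → Carrier
  conv zero    u v = u 0 * v 0
  conv (suc j) u v = u 0 * v (suc j) + conv j (u ∘ suc) v

  δ₀ : ℕ → Carrier
  δ₀ zero    = 1#
  δ₀ (suc i) = 0#

  shiftʳ : (ℕ → Carrier) → ℕ → Carrier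
  shiftʳ u zero    = 0#
  shiftʳ u (suc i) = u i

  conv-congˡ : ∀ j {u u′} v → (∀ i → i ≤ j → u i ≈ u′ i) → conv j u v ≈ conv j u′ v
  conv-congˡ zero    v u≈u′ = *-congʳ (u≈u′ 0 z≤n)
  conv-congˡ (suc j) v u≈u′ =
    +-cong (*-congʳ (u≈u′ 0 z≤n)) (conv-congˡ j v (λ i i≤j → u≈u′ (suc i) (s≤s i≤j)))

  conv-zeroˡ : ∀ j v → conv j (λ _ → 0#) v ≈ 0#
  conv-zeroˡ zero    v = zeroˡ _
  conv-zeroˡ (suc j) v = trans (+-cong (zeroˡ _) (conv-zeroˡ j v)) (+-identityˡ _)

  conv-identityˡ : ∀ j v → conv j δ₀ v ≈ v j
  conv-identityˡ zero    v = *-identityˡ _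
  conv-identityˡ (suc j) v = trans (+-cong (*-identityˡ _) (conv-zeroˡ j v)) (+-identityʳ _)

  conv-distribʳ-+ : ∀ j u w v → conv j (λ i → u i + w i) v ≈ conv j u v + conv j w v
  conv-distribʳ-+ zero    u w v = distribʳ _ _ _
  conv-distribʳ-+ (suc j) u w v =
    trans (+-cong (distribʳ _ _ _) (conv-distribʳ-+ j (u ∘ suc) (w ∘ suc) v)) (+-interchange _ _ _ _)

  conv-*ˡ : ∀ j x u v → conv j (λ i → x * u i) v ≈ x * conv j u v
  conv-*ˡ zero    x u v = *-assoc _ _ _
  conv-*ˡ (suc j) x u v =
    trans (+-cong (*-assoc _ _ _) (conv-*ˡ j x (u ∘ suc) v)) (sym (distribˡ _ _ _))

  conv-shiftʳ : ∀ j u v → conv (suc j) (shiftʳ u) v ≈ conv j u v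
  conv-shiftʳ j u v = trans (+-congʳ (zeroˡ _)) (+-identityˡ _)

module SymmetricPolynomials (F : FiniteField) where
  open import Data.Nat as ℕ using (ℕ; zero; suc; _<_; z≤n; s≤s)
  import Data.Nat.Properties as ℕ
  open import Data.Nat.Combinatorics using (_C_; nCk+nC[k+1]≡[n+1]C[k+1])
  open import Data.List using (List; []; _∷_; _++_; replicate)
  open import Data.List.Relation.Binary.Permutation.Propositional as ↭ using (_↭_)
  open import Relation.Binary.PropositionalEquality as ≡ using (_≡_)

  open FiniteField F
  open Convolution semiring
  open import Algebra.Properties.Semiring.Mult semiring using (_×_; ×-homo-+; ×-comm-*; ×-congˡ)
  open import Algebra.Properties.Semiring.Exp semiring using (_^_)
  open import Algebra.Properties.CommutativeSemigroup +-commutativeSemigroup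
    using () renaming (interchange to +-interchange; xy∙z≈xz∙y to +-right-comm)
  open import Algebra.Properties.CommutativeSemigroup *-commutativeSemigroup
    using () renaming (x∙yz≈y∙xz to *-left-comm)
  open import Relation.Binary.Reasoning.Setoid setoid

  private
    e : ℕ → List Carrier → Carrier
    e = esym F

  esym-[] : ∀ i → e i [] ≈ δ₀ i
  esym-[] zero    = refl
  esym-[] (suc i) = refl

  esym-∷ : ∀ i x xs → e i (x ∷ xs) ≈ e i xs + x * shiftʳ (λ l → e l xs) i
  esym-∷ zero    x xs = sym (trans (+-congˡ (zeroʳ x)) (+-identityʳ _))
  esym-∷ (suc i) x xs = refl

  esym-++ : ∀ j xs ys → e j (xs ++ ys) ≈ conv j (λ i → e i xs) (λ l → e l ys)
  esym-++ j       []       ys = sym (trans (conv-congˡ j _ (λ i _ → esym-[] i)) (conv-identityˡ j _))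
  esym-++ zero    (x ∷ xs) ys = sym (*-identityˡ 1#)
  esym-++ (suc j) (x ∷ xs) ys = begin
    e (suc j) (xs ++ ys) + x * e j (xs ++ ys)
      ≈⟨ +-cong (esym-++ (suc j) xs ys) (*-congˡ (esym-++ j xs ys)) ⟩
    conv (suc j) E V + x * conv j E V
      ≈⟨ +-congˡ (sym (trans (conv-*ˡ (suc j) x (shiftʳ E) V)
                             (*-congˡ (conv-shiftʳ j E V)))) ⟩
    conv (suc j) E V + conv (suc j) (λ i → x * shiftʳ E i) V
      ≈⟨ sym (conv-distribʳ-+ (suc j) E (λ i → x * shiftʳ E i) V) ⟩
    conv (suc j) (λ i → E i + x * shiftʳ E i) V
      ≈⟨ conv-congˡ (suc j) V (λ i _ → sym (esym-∷ i x xs)) ⟩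
    conv (suc j) (λ i → e i (x ∷ xs)) V ∎
    where
    E V : ℕ → Carrier
    E i = e i xs
    V l = e l ys

  esym-replicate : ∀ N i a → e i (replicate N a) ≈ (N C i) × (a ^ i)
  esym-replicate N       zero    a = sym (+-identityʳ 1#)
  esym-replicate zero    (suc i) a = refl
  esym-replicate (suc N) (suc i) a = begin
    e (suc i) (replicate N a) + a * e i (replicate N a)
      ≈⟨ +-cong (esym-replicate N (suc i) a) (*-congˡ (esym-replicate N i a)) ⟩
    (N C suc i) × (a ^ suc i) + a * (N C i) × (a ^ i)
      ≈⟨ +-congˡ (×-comm-* (N C i) a (a ^ i)) ⟩
    (N C suc i) × (a ^ suc i) + (N C i) × (a ^ suc i)
      ≈⟨ sym (×-homo-+ (a ^ suc i) (N C suc i) (N C i)) ⟩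
    (N C suc i ℕ.+ N C i) × (a ^ suc i)
      ≈⟨ ×-congˡ (≡.trans (ℕ.+-comm (N C suc i) (N C i)) (nCk+nC[k+1]≡[n+1]C[k+1] N i)) ⟩
    (suc N C suc i) × (a ^ suc i) ∎

  BinomialsVanish : ℕ → Set
  BinomialsVanish D = ∀ i x → 0 < i → i < D → (D C i) × x ≈ 0#

  esym-replicate-++ : ∀ {D} → BinomialsVanish D → ∀ a ys j → j < D → e j (replicate D a ++ ys) ≈ e j ys
  esym-replicate-++ {D} vanish a ys j j<D = begin
    e j (replicate D a ++ ys)                     ≈⟨ esym-++ j (replicate D a) ys ⟩
    conv j (λ i → e i (replicate D a)) V ≈⟨ conv-congˡ j V coefficient ⟩
    conv j (δ₀) V               ≈⟨ conv-identityˡ j V ⟩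
    e j ys                                        ∎
    where
    V : ℕ → Carrier
    V l = e l ys
    coefficient : ∀ i → i ℕ.≤ j → e i (replicate D a) ≈ δ₀ i
    coefficient zero    _   = refl
    coefficient (suc i) i≤j =
      trans (esym-replicate D (suc i) a) (vanish (suc i) (a ^ suc i) (s≤s z≤n) (ℕ.≤-<-trans i≤j j<D))

  esym-swap : ∀ k x y zs → e k (x ∷ y ∷ zs) ≈ e k (y ∷ x ∷ zs)
  esym-swap zero          x y zs = refl
  esym-swap (suc zero)    x y zs = +-right-comm _ _ _
  esym-swap (suc (suc k)) x y zs = begin
    (a + y * b) + x * (b + y * c)       ≈⟨ +-congˡ (distribˡ x b (y * c)) ⟩
    (a + y * b) + (x * b + x * (y * c)) ≈⟨ +-interchange a (y * b) (x * b) (x * (y * c)) ⟩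
    (a + x * b) + (y * b + x * (y * c)) ≈⟨ +-congˡ (+-congˡ (*-left-comm x y c)) ⟩
    (a + x * b) + (y * b + y * (x * c)) ≈⟨ +-congˡ (sym (distribˡ y b (x * c))) ⟩
    (a + x * b) + y * (b + x * c)       ∎
    where
    a b c : Carrier
    a = e (suc (suc k)) zs
    b = e (suc k) zs
    c = e k zs

  esym-∷⁺ : ∀ x {xs ys} k → (∀ l → l ℕ.≤ k → e l xs ≈ e l ys) → e k (x ∷ xs) ≈ e k (x ∷ ys)
  esym-∷⁺ x zero    xs≈ys = refl
  esym-∷⁺ x (suc k) xs≈ys = +-cong (xs≈ys (suc k) ℕ.≤-refl) (*-congˡ (xs≈ys k (ℕ.n≤1+n k)))

  esym-↭ : ∀ {xs ys} → xs ↭ ys → ∀ k → e k xs ≈ e k ys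
  esym-↭ ↭.refl                   k = refl
  esym-↭ (↭.prep x p)             k = esym-∷⁺ x k (λ l _ → esym-↭ p l)
  esym-↭ (↭.swap {xs = zs} x y p) k =
    trans (esym-swap k x y zs) (esym-∷⁺ y k (λ l _ → esym-∷⁺ x l (λ l′ _ → esym-↭ p l′)))
  esym-↭ (↭.trans p q)            k = trans (esym-↭ p k) (esym-↭ q k)

  esym-∷-cong : ∀ {x y} xs k → x ≈ y → e k (x ∷ xs) ≈ e k (y ∷ xs)
  esym-∷-cong xs zero    x≈y = refl
  esym-∷-cong xs (suc k) x≈y = +-congˡ (*-congʳ x≈y)

  esym-∷-0 : ∀ {x} xs k → x ≈ 0# → e k (x ∷ xs) ≈ e k xs
  esym-∷-0 xs zero    x≈0 = refl
  esym-∷-0 xs (suc k) x≈0 = trans (+-congˡ (trans (*-congʳ x≈0) (zeroˡ _))) (+-identityʳ _)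

module PrimePowerBinomial where
  open import Data.Nat
  open import Data.Nat.Properties
  open import Data.Nat.Combinatorics using (_C_; nC1≡n; nCk+nC[k+1]≡[n+1]C[k+1])
  open import Data.Nat.Divisibility
  open import Data.Nat.Primality using (Prime; prime⇒nonZero; euclidsLemma)
  open import Data.Nat.Tactic.RingSolver using (solve-∀)
  open import Data.Sum using (inj₁; inj₂)
  open import Data.Empty using (⊥-elim)
  open import Relation.Nullary using (¬_; yes; no)
  open import Relation.Binary.PropositionalEquality

  [k+1]*[n+1]C[k+1]≡[n+1]*nCk : ∀ n k → suc k * (suc n C suc k) ≡ suc n * (n C k)
  [k+1]*[n+1]C[k+1]≡[n+1]*nCk zero    zero    = refl
  [k+1]*[n+1]C[k+1]≡[n+1]*nCk zero    (suc k) = *-zeroʳ (suc (suc k))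
  [k+1]*[n+1]C[k+1]≡[n+1]*nCk (suc n) zero    = trans (+-identityʳ _) (trans (nC1≡n (suc (suc n))) (sym (*-identityʳ _)))
  [k+1]*[n+1]C[k+1]≡[n+1]*nCk (suc n) (suc k) = begin
    suc (suc k) * (suc (suc n) C suc (suc k))  ≡⟨ cong (suc (suc k) *_) (sym (nCk+nC[k+1]≡[n+1]C[k+1] (suc n) (suc k))) ⟩
    suc (suc k) * (a + b)                      ≡⟨ regroup k a b ⟩
    (suc k * a + suc (suc k) * b) + a          ≡⟨ cong (_+ a) (cong₂ _+_ ([k+1]*[n+1]C[k+1]≡[n+1]*nCk n k)
                                                                     ([k+1]*[n+1]C[k+1]≡[n+1]*nCk n (suc k))) ⟩
    (suc n * (n C k) + suc n * (n C suc k)) + a ≡⟨ cong (_+ a) (sym (*-distribˡ-+ (suc n) (n C k) (n C suc k))) ⟩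
    suc n * (n C k + n C suc k) + a            ≡⟨ cong (λ c → suc n * c + a) (nCk+nC[k+1]≡[n+1]C[k+1] n k) ⟩
    suc n * a + a                              ≡⟨ +-comm (suc n * a) a ⟩
    suc (suc n) * a                            ∎
    where
    open ≡-Reasoning
    a b : ℕ
    a = suc n C suc k
    b = suc n C suc (suc k)
    regroup : ∀ k a b → suc (suc k) * (a + b) ≡ (suc k * a + suc (suc k) * b) + a
    regroup = solve-∀

  prime^∣*⇒∣ : ∀ {p} → Prime p → ∀ s m n → ¬ p ∣ n → p ^ s ∣ m * n → p ^ s ∣ m
  prime^∣*⇒∣ p-prime zero    m n p∤n _ = 1∣ m
  prime^∣*⇒∣ {p} p-prime (suc s) m n p∤n p^s∣mn with euclidsLemma m n p-prime (∣-trans (m∣m*n (p ^ s)) p^s∣mn)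
  ... | inj₂ p∣n = ⊥-elim (p∤n p∣n)
  ... | inj₁ (divides m′ refl) = subst (_∣ m′ * p) (*-comm (p ^ s) p) (*-monoˡ-∣ p p^s∣m′)
    where
    instance
      p≢0 : NonZero p
      p≢0 = prime⇒nonZero p-prime
    p^s∣m′ : p ^ s ∣ m′
    p^s∣m′ = prime^∣*⇒∣ p-prime s m′ n p∤n (*-cancelˡ-∣ p (subst (p * p ^ s ∣_) (reassoc m′ p n) p^s∣mn))
      where
      reassoc : ∀ m p n → m * p * n ≡ p * (m * n)
      reassoc = solve-∀

  -- j · C(p^s, j) = p^s · C(p^s − 1, j − 1), so p ∤ C(p^s, j) would force p^s ∣ j.
  p∣[p^s]Cj : ∀ {p} → Prime p → ∀ s j → 0 < j → j < p ^ s → p ∣ (p ^ s) C j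
  p∣[p^s]Cj {p} p-prime s (suc k) _ j<p^s = p∣NC[k+1] (p ^ s) refl j<p^s
    where
    p∣NC[k+1] : ∀ N → N ≡ p ^ s → suc k < N → p ∣ N C suc k
    p∣NC[k+1] (suc n) N≡p^s k<N with p ∣? (suc n C suc k)
    ... | yes p∣C = p∣C
    ... | no  p∤C = ⊥-elim (<⇒≱ k<N (∣⇒≤ (subst (_∣ suc k) (sym N≡p^s) p^s∣k+1)))
      where
      p^s∣k+1 : p ^ s ∣ suc k
      p^s∣k+1 = prime^∣*⇒∣ p-prime s (suc k) (suc n C suc k) p∤C
        (subst₂ _∣_ N≡p^s (sym ([k+1]*[n+1]C[k+1]≡[n+1]*nCk n k)) (m∣m*n (n C k)))

module Characteristic where
  open import Algebra.Bundles using (Ring)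
  open import Data.Nat as ℕ using (ℕ; zero; suc)
  open import Data.Nat.Divisibility using (_∣_; divides)
  open import Data.Fin using (Fin)
  open import Data.Fin.Permutation using (Permutation; permutation)
  open import Data.Product using (proj₁; proj₂)
  open import Relation.Nullary using (yes; no; contradiction)
  open import Relation.Binary.PropositionalEquality as ≡ using (_≡_)

  module Enumeration (F : FiniteField) where
    open FiniteField F

    index : Carrier → Fin size
    index x = proj₁ (enum-surjective x)

    enum-index : ∀ x → enum (index x) ≈ x
    enum-index x = proj₂ (enum-surjective x)

    index-cong : ∀ {x y} → x ≈ y → index x ≡ index y
    index-cong {x} {y} x≈y = enum-injective _ _ (trans (enum-index x) (trans x≈y (sym (enum-index y))))

    index-enum : ∀ i → index (enum i) ≡ i
    index-enum i = enum-injective _ _ (enum-index (enum i))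

  module _ {c ℓ} (R : Ring c ℓ) where
    open Ring R
    open import Algebra.Properties.Semiring.Mult semiring using (_×_; ×-congʳ; ×-assoc-*; ×1-homo-*)
    open import Relation.Binary.Reasoning.Setoid setoid

    ×-vanishes-on-multiples : ∀ {p n} → p × 1# ≈ 0# → p ∣ n → ∀ x → n × x ≈ 0#
    ×-vanishes-on-multiples {p} {n} p×1≈0 (divides m ≡.refl) x = begin
      n × x                       ≈⟨ ×-congʳ n (sym (*-identityˡ x)) ⟩
      n × (1# * x)                ≈⟨ ×-assoc-* n 1# x ⟨
      (n × 1#) * x                ≈⟨ *-congʳ (×1-homo-* m p) ⟩
      ((m × 1#) * (p × 1#)) * x   ≈⟨ *-congʳ (*-congˡ p×1≈0) ⟩
      ((m × 1#) * 0#) * x         ≈⟨ *-congʳ (zeroʳ _) ⟩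
      0# * x                      ≈⟨ zeroˡ x ⟩
      0#                          ∎

  module _ (F : FiniteField) where
    open FiniteField F
    open Enumeration F
    open import Algebra.Properties.Semiring.Mult semiring using (_×_; ×1-homo-*)
    open import Algebra.Properties.Semiring.Exp semiring using (_^_; ^-congˡ)
    open import Algebra.Properties.CommutativeSemiring.Exp commutativeSemiring using (^-distrib-*)
    open import Algebra.Properties.CommutativeMonoid.Sum +-commutativeMonoid
      using (sum; sum-permute; ∑-distrib-+; sum-replicate; sum-cong-≋)
    open import Algebra.Properties.Group +-group using (identityˡ-unique; \\-leftDividesˡ; \\-leftDividesʳ)
    open import Relation.Binary.Reasoning.Setoid setoid

    translation : Carrier → Permutation size size
    translation x = permutation (λ i → index (x + enum i)) (λ j → index (- x + enum j))
      (λ j → ≡.trans (index-cong (trans (+-congˡ (enum-index _)) (\\-leftDividesˡ x (enum j)))) (index-enum j))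
      (λ i → ≡.trans (index-cong (trans (+-congˡ (enum-index _)) (\\-leftDividesʳ x (enum i)))) (index-enum i))

    -- x + _ permutes F, so ∑ F = ∑ (x + F) = size × x + ∑ F.
    size×x≈0 : ∀ x → size × x ≈ 0#
    size×x≈0 x = identityˡ-unique (size × x) (sum enum) (sym (begin
      sum enum                      ≈⟨ sum-permute enum (translation x) ⟩
      sum (λ i → enum (index (x + enum i))) ≈⟨ sum-cong-≋ (λ i → enum-index (x + enum i)) ⟩
      sum (λ i → x + enum i)        ≈⟨ ∑-distrib-+ {size} (λ _ → x) enum ⟩
      sum {size} (λ _ → x) + sum enum ≈⟨ +-congʳ (sum-replicate size) ⟩
      size × x + sum enum           ∎))

    1#^n≈1# : ∀ n → 1# ^ n ≈ 1#
    1#^n≈1# zero    = refl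
    1#^n≈1# (suc n) = trans (*-identityˡ _) (1#^n≈1# n)

    ×1-homo-^ : ∀ p r → (p × 1#) ^ r ≈ (p ℕ.^ r) × 1#
    ×1-homo-^ p zero    = sym (+-identityʳ 1#)
    ×1-homo-^ p (suc r) = trans (*-congˡ (×1-homo-^ p r)) (sym (×1-homo-* p (p ℕ.^ r)))

    ^≈0⇒≈0 : ∀ {y} r → y ^ r ≈ 0# → y ≈ 0#
    ^≈0⇒≈0 {y} r y^r≈0 with y ≟ 0#
    ... | yes y≈0 = y≈0
    ... | no  y≉0 = contradiction (begin
      1#                ≈⟨ 1#^n≈1# r ⟨
      1# ^ r            ≈⟨ ^-congˡ r (proj₂ (inverse y y≉0)) ⟨
      (y * y⁻¹) ^ r     ≈⟨ ^-distrib-* y y⁻¹ r ⟩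
      y ^ r * y⁻¹ ^ r   ≈⟨ *-congʳ y^r≈0 ⟩
      0# * y⁻¹ ^ r      ≈⟨ zeroˡ _ ⟩
      0#                ∎) 1≉0
      where
      y⁻¹ : Carrier
      y⁻¹ = proj₁ (inverse y y≉0)

    p×1≈0 : ∀ p r → size ≡ p ℕ.^ r → p × 1# ≈ 0#
    p×1≈0 p r size≡p^r = ^≈0⇒≈0 r (trans (×1-homo-^ p r)
      (≡.subst (λ n → n × 1# ≈ 0#) size≡p^r (size×x≈0 1#)))

module Cyclic where
  open import Data.Nat as ℕ using (ℕ; zero; suc; _≤_; _<_; _∸_; _+_; s≤s)
  import Data.Nat.Properties as ℕ
  open import Data.Fin using (Fin; zero; suc; toℕ; fromℕ; fromℕ<; inject₁)
  open import Data.Fin.Properties using (toℕ-injective; toℕ-fromℕ<; toℕ-inject₁; toℕ-fromℕ; toℕ<n; toℕ≤pred[n])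
  open import Data.Product using (∃; _×_; _,_)
  open import Relation.Nullary using (yes; no; contradiction)
  open import Relation.Binary.PropositionalEquality

  module _ {n : ℕ} where

    cycSuc : Fin (suc n) → Fin (suc n)
    cycSuc i with toℕ i ℕ.<? n
    ... | yes i<n = fromℕ< (s≤s i<n)
    ... | no  _   = zero

    cycPred : Fin (suc n) → Fin (suc n)
    cycPred zero    = fromℕ n
    cycPred (suc i) = inject₁ i

    toℕ-cycSuc-< : ∀ i → toℕ i < n → toℕ (cycSuc i) ≡ suc (toℕ i)
    toℕ-cycSuc-< i i<n with toℕ i ℕ.<? n
    ... | yes i<n′ = toℕ-fromℕ< (s≤s i<n′)
    ... | no  i≮n  = contradiction i<n i≮n

    cycSuc-last : ∀ i → toℕ i ≡ n → cycSuc i ≡ zero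
    cycSuc-last i i≡n with toℕ i ℕ.<? n
    ... | yes i<n = contradiction i≡n (ℕ.<⇒≢ i<n)
    ... | no  _   = refl

    cycPred-cycSuc : ∀ i → cycPred (cycSuc i) ≡ i
    cycPred-cycSuc i with toℕ i ℕ.<? n
    ... | yes i<n = toℕ-injective (trans (toℕ-inject₁ _) (toℕ-fromℕ< _))
    ... | no  i≮n = toℕ-injective (trans (toℕ-fromℕ n) (ℕ.≤-antisym (ℕ.≮⇒≥ i≮n) (toℕ≤pred[n] i)))

    cycSuc-cycPred : ∀ i → cycSuc (cycPred i) ≡ i
    cycSuc-cycPred zero    = cycSuc-last (fromℕ n) (toℕ-fromℕ n)
    cycSuc-cycPred (suc i) = toℕ-injective (trans (toℕ-cycSuc-< (inject₁ i) i<n) (cong suc (toℕ-inject₁ i)))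
      where
      i<n : toℕ (inject₁ i) < n
      i<n = subst (_< n) (sym (toℕ-inject₁ i)) (toℕ<n i)

    cycPred^ : ℕ → Fin (suc n) → Fin (suc n)
    cycPred^ zero    i = i
    cycPred^ (suc s) i = cycPred^ s (cycPred i)

    cycPred^-+ : ∀ s t i → cycPred^ (s + t) i ≡ cycPred^ t (cycPred^ s i)
    cycPred^-+ zero    t i = refl
    cycPred^-+ (suc s) t i = cycPred^-+ s t (cycPred i)

    toℕ-cycPred^ : ∀ s i → s ≤ toℕ i → toℕ (cycPred^ s i) ≡ toℕ i ∸ s
    toℕ-cycPred^ zero    i       _         = refl
    toℕ-cycPred^ (suc s) (suc i) (s≤s s≤i) =
      trans (toℕ-cycPred^ s (inject₁ i) (subst (s ≤_) (sym (toℕ-inject₁ i)) s≤i)) (cong (_∸ s) (toℕ-inject₁ i))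

    cycPred^-reaches : ∀ i j → ∃ λ s → s ≤ n × cycPred^ s i ≡ j
    cycPred^-reaches i j with toℕ j ℕ.≤? toℕ i
    ... | yes j≤i = toℕ i ∸ toℕ j , ℕ.≤-trans (ℕ.m∸n≤m (toℕ i) (toℕ j)) (toℕ≤pred[n] i) ,
        toℕ-injective (trans (toℕ-cycPred^ _ i (ℕ.m∸n≤m (toℕ i) (toℕ j))) (ℕ.m∸[m∸n]≡n j≤i))
    ... | no  j≰i = suc (toℕ i) + (n ∸ toℕ j) , steps≤n , reaches
      where
      j≤n : toℕ j ≤ n
      j≤n = toℕ≤pred[n] j
      steps≤n : suc (toℕ i) + (n ∸ toℕ j) ≤ n
      steps≤n = subst (suc (toℕ i) + (n ∸ toℕ j) ≤_) (ℕ.m+[n∸m]≡n j≤n) (ℕ.+-monoˡ-≤ (n ∸ toℕ j) (ℕ.≰⇒> j≰i))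
      toZero : cycPred^ (toℕ i) i ≡ zero
      toZero = toℕ-injective (trans (toℕ-cycPred^ (toℕ i) i ℕ.≤-refl) (ℕ.n∸n≡0 (toℕ i)))
      wrap : cycPred^ (suc (toℕ i)) i ≡ fromℕ n
      wrap = begin
        cycPred^ (suc (toℕ i)) i ≡⟨ cong (λ s → cycPred^ s i) (ℕ.+-comm 1 (toℕ i)) ⟩
        cycPred^ (toℕ i + 1) i ≡⟨ cycPred^-+ (toℕ i) 1 i ⟩
        cycPred (cycPred^ (toℕ i) i) ≡⟨ cong cycPred toZero ⟩
        fromℕ n ∎
        where open ≡-Reasoning
      reaches : cycPred^ (suc (toℕ i) + (n ∸ toℕ j)) i ≡ j
      reaches = begin
        cycPred^ (suc (toℕ i) + (n ∸ toℕ j)) i ≡⟨ cycPred^-+ (suc (toℕ i)) (n ∸ toℕ j) i ⟩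
        cycPred^ (n ∸ toℕ j) (cycPred^ (suc (toℕ i)) i) ≡⟨ cong (cycPred^ (n ∸ toℕ j)) wrap ⟩
        cycPred^ (n ∸ toℕ j) (fromℕ n) ≡⟨ toℕ-injective fromLast ⟩
        j ∎
        where
        open ≡-Reasoning
        fromLast : toℕ (cycPred^ (n ∸ toℕ j) (fromℕ n)) ≡ toℕ j
        fromLast = trans
          (toℕ-cycPred^ (n ∸ toℕ j) (fromℕ n) (subst (n ∸ toℕ j ≤_) (sym (toℕ-fromℕ n)) (ℕ.m∸n≤m n (toℕ j))))
          (trans (cong (_∸ (n ∸ toℕ j)) (toℕ-fromℕ n)) (ℕ.m∸[m∸n]≡n j≤n))

module Lists where
  open import Data.Nat using (suc)
  open import Data.Fin using (Fin; zero; suc)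
  open import Data.Fin.Properties using (suc-injective)
  open import Data.List using (List; []; _∷_; _++_; concat; map; tabulate; lookup)
  open import Data.List.Properties using (tabulate-cong; ++-assoc)
  open import Data.List.Relation.Binary.Permutation.Propositional using (_↭_; ↭-reflexive; ↭-trans)
  open import Data.List.Relation.Binary.Permutation.Propositional.Properties using (++⁺ˡ; shifts)
  open import Data.List.Relation.Unary.All as All using (All)
  open import Data.List.Relation.Unary.AllPairs using () renaming (_∷_ to _∷ᵘ_)
  open import Data.List.Membership.Propositional.Properties using (∈-lookup)
  open import Data.Empty using (⊥-elim)
  open import Function using (_∘_)
  open import Relation.Binary.Bundles using (Setoid)
  open import Relation.Binary.PropositionalEquality using (_≡_; _≢_; refl; cong; cong₂; trans)
  import Data.List.Relation.Unary.Unique.Setoid as Unique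

  concat-tabulate-↭ : ∀ {A : Set} {n} (f g : Fin n → List A) (i : Fin n) (xs : List A) →
    g i ≡ xs ++ f i → (∀ j → j ≢ i → g j ≡ f j) → concat (tabulate g) ↭ xs ++ concat (tabulate f)
  concat-tabulate-↭ {n = suc n} f g zero xs gᵢ≡ g≡f = ↭-reflexive (trans
    (cong₂ (λ u v → u ++ concat v) gᵢ≡ (tabulate-cong (λ j → g≡f (suc j) (λ ())))) (++-assoc xs (f zero) _))
  concat-tabulate-↭ {n = suc n} f g (suc i) xs gᵢ≡ g≡f = ↭-trans
    (↭-reflexive (cong (_++ concat (tabulate (g ∘ suc))) (g≡f zero (λ ()))))
    (↭-trans (++⁺ˡ (f zero) (concat-tabulate-↭ (f ∘ suc) (g ∘ suc) i xs gᵢ≡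
                                (λ j j≢i → g≡f (suc j) (j≢i ∘ suc-injective))))
             (shifts (f zero) xs))

  module _ {c ℓ} (S : Setoid c ℓ) where
    open Setoid S using (_≈_; sym)

    lookup-injective : ∀ {xs} → Unique.Unique S xs → ∀ i j → lookup xs i ≈ lookup xs j → i ≡ j
    lookup-injective (_  ∷ᵘ _) zero    zero    _ = refl
    lookup-injective (x≉ ∷ᵘ _) zero    (suc j) x≈ = ⊥-elim (All.lookup x≉ (∈-lookup j) x≈)
    lookup-injective (x≉ ∷ᵘ _) (suc i) zero    x≈ = ⊥-elim (All.lookup x≉ (∈-lookup i) (sym x≈))
    lookup-injective (_  ∷ᵘ u) (suc i) (suc j) x≈ = cong suc (lookup-injective u i j x≈)

  concat-map-[] : ∀ {A B : Set} (xs : List A) → concat (map (λ _ → []) xs) ≡ [] {A = B}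
  concat-map-[] []       = refl
  concat-map-[] (_ ∷ xs) = concat-map-[] xs

module VectorUpdates where
  open import Data.Fin as Fin using (Fin)
  open import Data.Vec.Functional using (Vector; updateAt)
  open import Data.Vec.Functional.Properties using (updateAt-updates; updateAt-minimal; updateAt-updateAt; updateAt-id-local)
  open import Function using (_∘_)
  open import Relation.Nullary using (yes; no)
  open import Relation.Binary.PropositionalEquality as ≡ using (_≡_; _≗_)

  module _ {A : Set} {n : ℕ} where

    updateAt-resp : ∀ j (f : A → A) {xs ys : Vector A n} → xs ≗ ys → updateAt xs j f ≗ updateAt ys j f
    updateAt-resp j f {xs} {ys} xs≗ys j′ with j′ Fin.≟ j
    ... | yes ≡.refl = ≡.trans (updateAt-updates j xs) (≡.trans (≡.cong f (xs≗ys j)) (≡.sym (updateAt-updates j ys)))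
    ... | no  j′≢j   =
      ≡.trans (updateAt-minimal j′ j xs j′≢j) (≡.trans (xs≗ys j′) (≡.sym (updateAt-minimal j′ j ys j′≢j)))

    updateAt-cancel : ∀ j {f g : A → A} → (∀ x → g (f x) ≡ x) → (xs : Vector A n) → updateAt (updateAt xs j f) j g ≗ xs
    updateAt-cancel j {f} {g} g∘f≗id xs j′ =
      ≡.trans (updateAt-updateAt j {f = g} {g = f} xs j′) (updateAt-id-local j {f = g ∘ f} xs (g∘f≗id (xs j)) j′)

module Sums where
  open import Data.Nat
  open import Data.Nat.Properties
  open import Data.Bool using (true; false; if_then_else_)
  open import Data.Fin as Fin using (Fin; zero; suc)
  import Data.Fin.Properties as Fin
  open import Data.List using (List; []; _∷_; _++_; map; concatMap; filter; length; allFin)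
  open import Data.List.Properties using (length-tabulate; map-tabulate)
  open import Data.Vec.Functional as Vector using (Vector; head; tail)
  open import Data.Empty using (⊥-elim)
  open import Function using (_∘_; _⇔_; mk⇔; Equivalence)
  open import Relation.Nullary using (Dec; yes; no; does; ¬_; ¬?; _×-dec_)
  open import Data.Product using (_×_; _,_)
  open import Relation.Unary using (Decidable)
  open import Relation.Binary.PropositionalEquality
  open import Algebra.Properties.CommutativeSemigroup +-commutativeSemigroup using () renaming (interchange to +-interchange)

  private
    variable
      A B : Set

  ∑ : List A → (A → ℕ) → ℕ
  ∑ []       f = 0
  ∑ (x ∷ xs) f = f x + ∑ xs f

  𝟙 : Dec A → ℕ
  𝟙 d = if does d then 1 else 0

  ∑-++ : ∀ (xs ys : List A) f → ∑ (xs ++ ys) f ≡ ∑ xs f + ∑ ys f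
  ∑-++ []       ys f = refl
  ∑-++ (x ∷ xs) ys f = trans (cong (f x +_) (∑-++ xs ys f)) (sym (+-assoc (f x) _ _))

  ∑-map : ∀ (g : A → B) (xs : List A) f → ∑ (map g xs) f ≡ ∑ xs (f ∘ g)
  ∑-map g []       f = refl
  ∑-map g (x ∷ xs) f = cong (f (g x) +_) (∑-map g xs f)

  ∑-concatMap : ∀ (g : A → List B) (xs : List A) f → ∑ (concatMap g xs) f ≡ ∑ xs (λ x → ∑ (g x) f)
  ∑-concatMap g []       f = refl
  ∑-concatMap g (x ∷ xs) f = trans (∑-++ (g x) (concatMap g xs) f) (cong (∑ (g x) f +_) (∑-concatMap g xs f))

  ∑-cong : ∀ (xs : List A) {f g : A → ℕ} → (∀ x → f x ≡ g x) → ∑ xs f ≡ ∑ xs g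
  ∑-cong []       f≡g = refl
  ∑-cong (x ∷ xs) f≡g = cong₂ _+_ (f≡g x) (∑-cong xs f≡g)

  ∑-distrib-+ : ∀ (xs : List A) f g → ∑ xs (λ x → f x + g x) ≡ ∑ xs f + ∑ xs g
  ∑-distrib-+ []       f g = refl
  ∑-distrib-+ (x ∷ xs) f g = trans (cong (f x + g x +_) (∑-distrib-+ xs f g)) (+-interchange (f x) (g x) _ _)

  ∑-distribˡ-* : ∀ (xs : List A) c f → ∑ xs (λ x → c * f x) ≡ c * ∑ xs f
  ∑-distribˡ-* []       c f = sym (*-zeroʳ c)
  ∑-distribˡ-* (x ∷ xs) c f = trans (cong (c * f x +_) (∑-distribˡ-* xs c f)) (sym (*-distribˡ-+ c (f x) _))

  ∑-mono-≤ : ∀ (xs : List A) {f g : A → ℕ} → (∀ x → f x ≤ g x) → ∑ xs f ≤ ∑ xs g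
  ∑-mono-≤ []       f≤g = z≤n
  ∑-mono-≤ (x ∷ xs) f≤g = +-mono-≤ (f≤g x) (∑-mono-≤ xs f≤g)

  ∑-zero : ∀ (xs : List A) → ∑ xs (λ _ → 0) ≡ 0
  ∑-zero []       = refl
  ∑-zero (x ∷ xs) = ∑-zero xs

  ∑-one : ∀ (xs : List A) → ∑ xs (λ _ → 1) ≡ length xs
  ∑-one []       = refl
  ∑-one (x ∷ xs) = cong suc (∑-one xs)

  length-filter : ∀ {P : A → Set} (P? : Decidable P) (xs : List A) → length (filter P? xs) ≡ ∑ xs (𝟙 ∘ P?)
  length-filter P? []       = refl
  length-filter P? (x ∷ xs) with does (P? x)
  ... | true  = cong suc (length-filter P? xs)
  ... | false = length-filter P? xs

  𝟙-yes : ∀ (d : Dec A) → A → 𝟙 d ≡ 1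
  𝟙-yes (yes _) _ = refl
  𝟙-yes (no ¬a) a = ⊥-elim (¬a a)

  𝟙-no : ∀ (d : Dec A) → ¬ A → 𝟙 d ≡ 0
  𝟙-no (yes a) ¬a = ⊥-elim (¬a a)
  𝟙-no (no _)  _  = refl

  𝟙-≤1 : ∀ (d : Dec A) → 𝟙 d ≤ 1
  𝟙-≤1 (yes _) = s≤s z≤n
  𝟙-≤1 (no _)  = z≤n

  𝟙+𝟙¬≡1 : ∀ (d : Dec A) → 𝟙 d + 𝟙 (¬? d) ≡ 1
  𝟙+𝟙¬≡1 (yes _) = refl
  𝟙+𝟙¬≡1 (no _)  = refl

  𝟙-cong : ∀ (d : Dec A) (d′ : Dec B) → A ⇔ B → 𝟙 d ≡ 𝟙 d′
  𝟙-cong (yes a) d′ A⇔B = sym (𝟙-yes d′ (Equivalence.to A⇔B a))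
  𝟙-cong (no ¬a) d′ A⇔B = sym (𝟙-no d′ (¬a ∘ Equivalence.from A⇔B))

  _≗?_ : ∀ {n m} (c c′ : Vector (Fin m) n) → Dec (c ≗ c′)
  c ≗? c′ = Fin.all? (λ j → c j Fin.≟ c′ j)

  ≗-Invariant : ∀ {n m} → (Vector (Fin m) n → ℕ) → Set
  ≗-Invariant W = ∀ {c c′} → c ≗ c′ → W c ≡ W c′

  ∑-allFuns-suc : ∀ n m (f : Vector (Fin m) (suc n) → ℕ) →
    ∑ (allFuns (suc n) m) f ≡ ∑ (allFin m) (λ i → ∑ (allFuns n m) (λ v → f (i Vector.∷ v)))
  ∑-allFuns-suc n m f = trans (∑-concatMap (λ i → map (i Vector.∷_) (allFuns n m)) (allFin m) f)
    (∑-cong (allFin m) (λ i → ∑-map (i Vector.∷_) (allFuns n m) f))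

  length-allFuns : ∀ n m → length (allFuns n m) ≡ m ^ n
  length-allFuns zero    m = refl
  length-allFuns (suc n) m = begin
    length (allFuns (suc n) m)                               ≡⟨ ∑-one (allFuns (suc n) m) ⟨
    ∑ (allFuns (suc n) m) (λ _ → 1)                          ≡⟨ ∑-allFuns-suc n m (λ _ → 1) ⟩
    ∑ (allFin m) (λ _ → ∑ (allFuns n m) (λ _ → 1))
      ≡⟨ ∑-cong (allFin m) (λ _ → trans (∑-one (allFuns n m)) (length-allFuns n m)) ⟩
    ∑ (allFin m) (λ _ → m ^ n)                               ≡⟨ ∑-cong (allFin m) (λ _ → *-identityʳ (m ^ n)) ⟨
    ∑ (allFin m) (λ _ → m ^ n * 1)                           ≡⟨ ∑-distribˡ-* (allFin m) (m ^ n) (λ _ → 1) ⟩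
    m ^ n * ∑ (allFin m) (λ _ → 1)                           ≡⟨ cong (m ^ n *_) (trans (∑-one (allFin m)) (length-tabulate _)) ⟩
    m ^ n * m                                                ≡⟨ *-comm (m ^ n) m ⟩
    m ^ suc n                                                ∎
    where open ≡-Reasoning

  ∑-allFin-suc : ∀ m f → ∑ (allFin (suc m)) f ≡ f zero + ∑ (allFin m) (f ∘ suc)
  ∑-allFin-suc m f = cong (f zero +_) (trans (cong (λ is → ∑ is f) (sym (map-tabulate (λ i → i) suc))) (∑-map suc (allFin m) f))

  ∑-allFin-δ : ∀ m (i₀ : Fin m) (W : Fin m → ℕ) → ∑ (allFin m) (λ i → 𝟙 (i₀ Fin.≟ i) * W i) ≡ W i₀
  ∑-allFin-δ (suc m) zero     W = trans (∑-allFin-suc m (λ i → 𝟙 (zero Fin.≟ i) * W i))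
    (trans (cong (λ s → W zero + 0 + s) (∑-zero (allFin m))) (trans (+-identityʳ _) (+-identityʳ _)))
  ∑-allFin-δ (suc m) (suc i₀) W = trans (∑-allFin-suc m (λ i → 𝟙 (suc i₀ Fin.≟ i) * W i)) (trans
    (∑-cong (allFin m) (λ i → cong (_* W (suc i)) (𝟙-cong (suc i₀ Fin.≟ suc i) (i₀ Fin.≟ i) (mk⇔ Fin.suc-injective (cong suc)))))
    (∑-allFin-δ m i₀ (W ∘ suc)))

  𝟙-× : ∀ {C : Set} (d : Dec A) (d₁ : Dec B) (d₂ : Dec C) → A ⇔ (B × C) → 𝟙 d ≡ 𝟙 d₁ * 𝟙 d₂
  𝟙-× d d₁ d₂ A⇔B×C = trans (𝟙-cong d (d₁ ×-dec d₂) A⇔B×C) (𝟙×𝟙 d₁ d₂)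
    where
    𝟙×𝟙 : ∀ {B C : Set} (d₁ : Dec B) (d₂ : Dec C) → 𝟙 (d₁ ×-dec d₂) ≡ 𝟙 d₁ * 𝟙 d₂
    𝟙×𝟙 (yes _) (yes _) = refl
    𝟙×𝟙 (yes _) (no _)  = refl
    𝟙×𝟙 (no _)  _       = refl

  ∑-allFuns-δ : ∀ n m (g : Vector (Fin m) n) (W : Vector (Fin m) n → ℕ) → ≗-Invariant W →
    ∑ (allFuns n m) (λ g′ → 𝟙 (g ≗? g′) * W g′) ≡ W g
  ∑-allFuns-δ zero    m g W inv = trans (+-identityʳ _)
    (trans (cong (_* W (λ ())) (𝟙-yes (g ≗? (λ ())) (λ ()))) (trans (+-identityʳ _) (inv (λ ()))))
  ∑-allFuns-δ (suc n) m g W inv = begin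
    ∑ (allFuns (suc n) m) (λ g′ → 𝟙 (g ≗? g′) * W g′)
      ≡⟨ ∑-allFuns-suc n m _ ⟩
    ∑ (allFin m) (λ i → ∑ (allFuns n m) (λ g′ → 𝟙 (g ≗? (i Vector.∷ g′)) * W (i Vector.∷ g′)))
      ≡⟨ ∑-cong (allFin m) fibre ⟩
    ∑ (allFin m) (λ i → 𝟙 (head g Fin.≟ i) * W (i Vector.∷ tail g))
      ≡⟨ ∑-allFin-δ m (head g) (λ i → W (i Vector.∷ tail g)) ⟩
    W (head g Vector.∷ tail g)
      ≡⟨ inv (λ { zero → refl ; (suc j) → refl }) ⟩
    W g ∎
    where
    open ≡-Reasoning
    split : ∀ i g′ → g ≗ (i Vector.∷ g′) ⇔ (head g ≡ i × tail g ≗ g′)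
    split i g′ = mk⇔ (λ g≗ → g≗ zero , g≗ ∘ suc)
                     (λ { (g₀≡i , _) zero → g₀≡i ; (_ , g₊≗g′) (suc j) → g₊≗g′ j })
    fibre : ∀ i → ∑ (allFuns n m) (λ g′ → 𝟙 (g ≗? (i Vector.∷ g′)) * W (i Vector.∷ g′))
                ≡ 𝟙 (head g Fin.≟ i) * W (i Vector.∷ tail g)
    fibre i = begin
      ∑ (allFuns n m) (λ g′ → 𝟙 (g ≗? (i Vector.∷ g′)) * W (i Vector.∷ g′))
        ≡⟨ ∑-cong (allFuns n m) (λ g′ → trans
             (cong (_* W (i Vector.∷ g′)) (𝟙-× (g ≗? (i Vector.∷ g′)) (head g Fin.≟ i) (tail g ≗? g′) (split i g′)))
                                               (*-assoc (𝟙 (head g Fin.≟ i)) _ _)) ⟩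
      ∑ (allFuns n m) (λ g′ → 𝟙 (head g Fin.≟ i) * (𝟙 (tail g ≗? g′) * W (i Vector.∷ g′)))
        ≡⟨ ∑-distribˡ-* (allFuns n m) (𝟙 (head g Fin.≟ i)) _ ⟩
      𝟙 (head g Fin.≟ i) * ∑ (allFuns n m) (λ g′ → 𝟙 (tail g ≗? g′) * W (i Vector.∷ g′))
        ≡⟨ cong (𝟙 (head g Fin.≟ i) *_) (∑-allFuns-δ n m (tail g) (W ∘ (i Vector.∷_))
                                            (λ c≗c′ → inv (λ { zero → refl ; (suc j) → c≗c′ j }))) ⟩
      𝟙 (head g Fin.≟ i) * W (i Vector.∷ tail g) ∎

  ∑-fibres : ∀ {n m} (xs : List A) (κ : A → Vector (Fin m) n) (W : Vector (Fin m) n → ℕ) → ≗-Invariant W →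
    ∑ xs (W ∘ κ) ≡ ∑ (allFuns n m) (λ g → ∑ xs (λ x → 𝟙 (κ x ≗? g)) * W g)
  ∑-fibres {n = n} {m} []       κ W inv = sym (∑-zero (allFuns n m))
  ∑-fibres {n = n} {m} (x ∷ xs) κ W inv = begin
    W (κ x) + ∑ xs (W ∘ κ)
      ≡⟨ cong₂ _+_ (sym (∑-allFuns-δ n m (κ x) W inv)) (∑-fibres xs κ W inv) ⟩
    ∑ gs (λ g → 𝟙 (κ x ≗? g) * W g) + ∑ gs (λ g → ∑ xs (λ y → 𝟙 (κ y ≗? g)) * W g)
      ≡⟨ ∑-distrib-+ gs _ _ ⟨
    ∑ gs (λ g → 𝟙 (κ x ≗? g) * W g + ∑ xs (λ y → 𝟙 (κ y ≗? g)) * W g)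
      ≡⟨ ∑-cong gs (λ g → *-distribʳ-+ (W g) (𝟙 (κ x ≗? g)) _) ⟨
    ∑ gs (λ g → (𝟙 (κ x ≗? g) + ∑ xs (λ y → 𝟙 (κ y ≗? g))) * W g) ∎
    where
    open ≡-Reasoning
    gs : List (Vector (Fin m) n)
    gs = allFuns n m

  ∑𝟙-positive : ∀ n m {P : Vector (Fin m) n → Set} (P? : Decidable P) → (∀ {c c′} → c ≗ c′ → P c → P c′) →
    ∀ {w} → P w → 1 ≤ ∑ (allFuns n m) (𝟙 ∘ P?)
  ∑𝟙-positive n m P? resp {w} Pw = begin
    1                                                ≡⟨ 𝟙-yes (P? w) Pw ⟨
    𝟙 (P? w)                                         ≡⟨ ∑-allFuns-δ n m w (𝟙 ∘ P?) invariant ⟨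
    ∑ (allFuns n m) (λ g → 𝟙 (w ≗? g) * 𝟙 (P? g))
      ≤⟨ ∑-mono-≤ (allFuns n m) (λ g → *-monoˡ-≤ (𝟙 (P? g)) (𝟙-≤1 (w ≗? g))) ⟩
    ∑ (allFuns n m) (λ g → 1 * 𝟙 (P? g))             ≡⟨ ∑-cong (allFuns n m) (λ g → *-identityˡ (𝟙 (P? g))) ⟩
    ∑ (allFuns n m) (𝟙 ∘ P?)                         ∎
    where
    open ≤-Reasoning
    invariant : ≗-Invariant (𝟙 ∘ P?)
    invariant {c} {c′} c≗c′ = 𝟙-cong (P? c) (P? c′) (mk⇔ (resp c≗c′) (resp (sym ∘ c≗c′)))

module NonzeroElements (F : FiniteField) where
  open Characteristic using (module Enumeration)
  open Lists using (lookup-injective)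
  open Sums
  open import Data.Nat as ℕ using (ℕ)
  import Data.Nat.Properties as ℕ
  open import Data.Fin as Fin using (Fin)
  open import Data.List using (map; allFin; length; lookup)
  open import Data.List.Properties using (length-tabulate)
  open import Data.List.Relation.Unary.All as All using ()
  open import Data.List.Relation.Unary.All.Properties using (all-filter)
  open import Data.List.Relation.Unary.Any as Any using ()
  open import Data.List.Relation.Unary.Any.Properties using (lookup-index)
  open import Data.List.Membership.Propositional.Properties using (∈-lookup; ∈-allFin)
  import Data.List.Membership.Setoid as SetoidMembership
  import Data.List.Membership.Setoid.Properties as SetoidMembershipₚ
  import Data.List.Relation.Unary.Unique.Setoid.Properties as Uniqueₚ
  open import Data.List.Relation.Unary.Unique.Propositional.Properties using (allFin⁺)
  open import Function using (_∘_; mk⇔)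
  open import Relation.Nullary using (¬_; ¬?)
  open import Relation.Unary using (Decidable)
  open import Relation.Binary.PropositionalEquality as ≡ using (_≡_)

  open FiniteField F
  open Enumeration F
  open SetoidMembership setoid using (_∈_)

  K : ℕ
  K = length (nonzeros F)

  α : Fin K → Carrier
  α = lookup (nonzeros F)

  private
    nonzero? : Decidable (λ x → ¬ x ≈ 0#)
    nonzero? x = ¬? (x ≟ 0#)

  α≉0 : ∀ j → ¬ α j ≈ 0#
  α≉0 j = All.lookup (all-filter nonzero? (map enum (allFin size))) (∈-lookup j)

  α-injective : ∀ i j → α i ≈ α j → i ≡ j
  α-injective = lookup-injective setoid
    (Uniqueₚ.filter⁺ setoid nonzero?
      (Uniqueₚ.map⁺ (≡.setoid (Fin size)) setoid (λ {i} {j} → enum-injective i j) (allFin⁺ size)))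

  nonzeros-complete : ∀ {x} → ¬ x ≈ 0# → x ∈ nonzeros F
  nonzeros-complete {x} x≉0 = SetoidMembershipₚ.∈-filter⁺ setoid nonzero? (λ x≈y x≉0 y≈0 → x≉0 (trans x≈y y≈0))
    (SetoidMembershipₚ.∈-resp-≈ setoid (enum-index x)
      (SetoidMembershipₚ.∈-map⁺ (≡.setoid (Fin size)) setoid {f = enum} (λ { ≡.refl → refl }) (∈-allFin (index x))))
    x≉0

  nonzeroIndex : ∀ x → ¬ x ≈ 0# → Fin K
  nonzeroIndex x x≉0 = Any.index (nonzeros-complete x≉0)

  ≈α-nonzeroIndex : ∀ x x≉0 → x ≈ α (nonzeroIndex x x≉0)
  ≈α-nonzeroIndex x x≉0 = lookup-index (nonzeros-complete x≉0)

  length-nonzeros : K ≡ size ℕ.∸ 1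
  length-nonzeros = begin
    K                                  ≡⟨ length-filter nonzero? (map enum (allFin size)) ⟩
    ∑ (map enum (allFin size)) (𝟙 ∘ nonzero?) ≡⟨ ∑-map enum (allFin size) (𝟙 ∘ nonzero?) ⟩
    ∑ (allFin size) isNonzero          ≡⟨ ℕ.m+n∸m≡n 1 _ ⟨
    1 ℕ.+ ∑ (allFin size) isNonzero ℕ.∸ 1
                                       ≡⟨ ≡.cong (λ z → z ℕ.+ ∑ (allFin size) isNonzero ℕ.∸ 1) one-zero ⟨
    ∑ (allFin size) isZero ℕ.+ ∑ (allFin size) isNonzero ℕ.∸ 1
                                       ≡⟨ ≡.cong (ℕ._∸ 1) (∑-distrib-+ (allFin size) isZero isNonzero) ⟨
    ∑ (allFin size) (λ i → isZero i ℕ.+ isNonzero i) ℕ.∸ 1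
                                       ≡⟨ ≡.cong (ℕ._∸ 1) (∑-cong (allFin size) (λ i → 𝟙+𝟙¬≡1 (enum i ≟ 0#))) ⟩
    ∑ (allFin size) (λ _ → 1) ℕ.∸ 1    ≡⟨ ≡.cong (ℕ._∸ 1) (≡.trans (∑-one (allFin size)) (length-tabulate {n = size} (λ i → i))) ⟩
    size ℕ.∸ 1                         ∎
    where
    open ≡.≡-Reasoning
    isZero isNonzero : Fin size → ℕ
    isZero i = 𝟙 (enum i ≟ 0#)
    isNonzero i = 𝟙 (nonzero? (enum i))
    one-zero : ∑ (allFin size) isZero ≡ 1
    one-zero = ≡.trans (∑-cong (allFin size) (λ i → ≡.trans
        (𝟙-cong (enum i ≟ 0#) (index 0# Fin.≟ i) (mk⇔ (λ i≈0 → enum-injective _ _ (trans (enum-index 0#) (sym i≈0)))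
                                                     (λ { ≡.refl → enum-index 0# })))
        (≡.sym (ℕ.*-identityʳ _))))
      (∑-allFin-δ size (index 0#) (λ _ → 1))

module WordClasses (F : FiniteField) (D′ : ℕ) where
  open Characteristic using (module Enumeration)
  open SymmetricPolynomials F
  open NonzeroElements F
  open Cyclic
  open Lists using (concat-tabulate-↭; concat-map-[])
  open VectorUpdates
  open import Data.Nat as ℕ using (ℕ; zero; suc; _<_)
  import Data.Nat.Properties as ℕ
  open import Data.Fin as Fin using (Fin; zero; suc; toℕ)
  open import Data.Fin.Properties using (toℕ≤pred[n])
  open import Data.List using (List; []; _∷_; _++_; replicate; concat; map; tabulate; allFin)
  open import Data.List.Properties using (map-tabulate; map-cong; ++-identityʳ)
  open import Data.List.Relation.Binary.Permutation.Propositional as ↭ using (_↭_)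
  open import Data.Maybe using (Maybe; just; nothing)
  open import Data.Vec.Functional as Vector using (Vector; head; tail; updateAt)
  open import Data.Vec.Functional.Properties using (updateAt-updates; updateAt-minimal)
  open import Function using (_∘_)
  open import Relation.Nullary using (yes; no; contradiction)
  open import Relation.Binary.PropositionalEquality as ≡ using (_≡_; _≢_; _≗_)

  open FiniteField F hiding (zero)
  open Enumeration F

  D : ℕ
  D = suc D′

  -- A class records, for each nonzero element α j, its multiplicity modulo D.
  Class : Set
  Class = Vector (Fin D) K

  letter : Carrier → Maybe (Fin K)
  letter x with x ≟ 0#
  ... | yes _   = nothing
  ... | no  x≉0 = just (nonzeroIndex x x≉0)

  letter-0 : ∀ {x} → x ≈ 0# → letter x ≡ nothing
  letter-0 {x} x≈0 with x ≟ 0#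
  ... | yes _   = ≡.refl
  ... | no  x≉0 = contradiction x≈0 x≉0

  letter-α : ∀ {x} j → x ≈ α j → letter x ≡ just j
  letter-α {x} j x≈αj with x ≟ 0#
  ... | yes x≈0 = contradiction (trans (sym x≈αj) x≈0) (α≉0 j)
  ... | no  x≉0 = ≡.cong just (α-injective _ j (trans (sym (≈α-nonzeroIndex x x≉0)) x≈αj))

  move : (Fin D → Fin D) → Maybe (Fin K) → Class → Class
  move f nothing  c = c
  move f (just j) c = updateAt c j f

  advance retreat : Fin size → Class → Class
  advance i = move cycSuc (letter (enum i))
  retreat i = move cycPred (letter (enum i))

  classOf : ∀ {n} → Vector (Fin size) n → Class
  classOf {zero}  _ = λ _ → zero
  classOf {suc n} v = advance (head v) (classOf (tail v))

  advance-≗⇒≗-retreat : ∀ i c c′ → advance i c ≗ c′ → c ≗ retreat i c′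
  advance-≗⇒≗-retreat i c c′ = move-≗ (letter (enum i))
    where
    move-≗ : ∀ m → move cycSuc m c ≗ c′ → c ≗ move cycPred m c′
    move-≗ nothing  c≗c′ = c≗c′
    move-≗ (just j) c₊≗c′ j′ =
      ≡.trans (≡.sym (updateAt-cancel j {cycSuc} {cycPred} cycPred-cycSuc c j′)) (updateAt-resp j cycPred c₊≗c′ j′)

  ≗-retreat⇒advance-≗ : ∀ i c c′ → c ≗ retreat i c′ → advance i c ≗ c′
  ≗-retreat⇒advance-≗ i c c′ = move-≗ (letter (enum i))
    where
    move-≗ : ∀ m → c ≗ move cycPred m c′ → move cycSuc m c ≗ c′
    move-≗ nothing  c≗c′ = c≗c′
    move-≗ (just j) c≗c′₋ j′ =
      ≡.trans (updateAt-resp j cycSuc c≗c′₋ j′) (updateAt-cancel j {cycPred} {cycSuc} cycSuc-cycPred c′ j′)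

  blocks : Class → Fin K → List Carrier
  blocks c j = replicate (toℕ (c j)) (α j)

  -- Λ F k (toℕ ∘ c) is definitionally esym F k (multiset c).
  multiset : Class → List Carrier
  multiset c = concat (map (blocks c) (allFin K))

  multiset-cong : ∀ {c c′} → c ≗ c′ → multiset c ≡ multiset c′
  multiset-cong c≗c′ = ≡.cong concat (map-cong (λ j → ≡.cong (λ i → replicate (toℕ i) (α j)) (c≗c′ j)) (allFin K))

  multiset-tabulate : ∀ c → multiset c ≡ concat (tabulate (blocks c))
  multiset-tabulate c = ≡.cong concat (map-tabulate (λ j → j) (blocks c))

  blocks-updateAt : ∀ c j f j′ → j′ ≢ j → blocks (updateAt c j f) j′ ≡ blocks c j′
  blocks-updateAt c j f j′ j′≢j = ≡.cong (λ i → replicate (toℕ i) (α j′)) (updateAt-minimal j′ j c j′≢j)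

  module _ (vanish : BinomialsVanish D) where

    -- Adding α j either grows block j by one, or completes D copies of α j, which e_k cannot see.
    esym-advance : ∀ c j k → k < D → esym F k (α j ∷ multiset c) ≈ esym F k (multiset (updateAt c j cycSuc))
    esym-advance c j k k<D with toℕ (c j) ℕ.<? D′
    ... | yes cⱼ<D′ = sym (esym-↭ grown k)
      where
      gained : blocks (updateAt c j cycSuc) j ≡ α j ∷ blocks c j
      gained = ≡.cong (λ n → replicate n (α j))
        (≡.trans (≡.cong toℕ (updateAt-updates j c)) (toℕ-cycSuc-< (c j) cⱼ<D′))
      grown : multiset (updateAt c j cycSuc) ↭ α j ∷ multiset c
      grown = ≡.subst₂ _↭_ (≡.sym (multiset-tabulate _)) (≡.cong (α j ∷_) (≡.sym (multiset-tabulate c)))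
        (concat-tabulate-↭ (blocks c) (blocks (updateAt c j cycSuc)) j (α j ∷ []) gained
          (blocks-updateAt c j cycSuc))
    ... | no  cⱼ≮D′ = trans (esym-↭ (↭.prep (α j) wrapped) k)
                           (esym-replicate-++ vanish (α j) (multiset (updateAt c j cycSuc)) k k<D)
      where
      cⱼ≡D′ : toℕ (c j) ≡ D′
      cⱼ≡D′ = ℕ.≤-antisym (toℕ≤pred[n] (c j)) (ℕ.≮⇒≥ cⱼ≮D′)
      emptied : blocks c j ≡ replicate D′ (α j) ++ blocks (updateAt c j cycSuc) j
      emptied = ≡.trans (≡.cong (λ n → replicate n (α j)) cⱼ≡D′)
        (≡.trans (≡.sym (++-identityʳ _)) (≡.cong (λ i → replicate D′ (α j) ++ replicate (toℕ i) (α j))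
          (≡.sym (≡.trans (updateAt-updates j c) (cycSuc-last (c j) cⱼ≡D′)))))
      wrapped : multiset c ↭ replicate D′ (α j) ++ multiset (updateAt c j cycSuc)
      wrapped = ≡.subst₂ _↭_ (≡.sym (multiset-tabulate c)) (≡.cong (replicate D′ (α j) ++_) (≡.sym (multiset-tabulate _)))
        (concat-tabulate-↭ (blocks (updateAt c j cycSuc)) (blocks c) j (replicate D′ (α j)) emptied
          (λ j′ j′≢j → ≡.sym (blocks-updateAt c j cycSuc j′ j′≢j)))

    esym-∷-move : ∀ x c k → k < D → esym F k (x ∷ multiset c) ≈ esym F k (multiset (move cycSuc (letter x) c))
    esym-∷-move x c k k<D with x ≟ 0#
    ... | yes x≈0 = esym-∷-0 (multiset c) k x≈0
    ... | no  x≉0 = trans (esym-∷-cong (multiset c) k (≈α-nonzeroIndex x x≉0)) (esym-advance c _ k k<D)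

    esym-classOf : ∀ {n} (v : Vector (Fin size) n) k → k < D →
      esym F k (Vector.toList (enum ∘ v)) ≈ esym F k (multiset (classOf v))
    esym-classOf {zero}  v k k<D = ≡.subst (λ xs → esym F k [] ≈ esym F k xs) (≡.sym (concat-map-[] (allFin K))) refl
    esym-classOf {suc n} v k k<D = trans
      (esym-∷⁺ (enum (head v)) k (λ l l≤k → esym-classOf (tail v) l (ℕ.≤-<-trans l≤k k<D)))
      (esym-∷-move (enum (head v)) (classOf (tail v)) k k<D)

  retreat-0 : ∀ c → retreat (index 0#) c ≡ c
  retreat-0 c = ≡.cong (λ m → move cycPred m c) (letter-0 (enum-index 0#))

  retreat-α : ∀ j c → retreat (index (α j)) c ≡ updateAt c j cycPred
  retreat-α j c = ≡.cong (λ m → move cycPred m c) (letter-α j (enum-index (α j)))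

module Counting (F : FiniteField) (D′ : ℕ) where
  open Characteristic using (module Enumeration)
  open Cyclic
  open Sums
  open import Data.Nat as ℕ using (ℕ; zero; suc; _+_; _*_; _^_; _≤_; _<_; z≤n; s≤s)
  import Data.Nat.Properties as ℕ
  open import Data.Fin as Fin using (Fin; zero; suc; toℕ; fromℕ<)
  import Data.Fin.Properties as Fin
  open import Data.List using (List; []; _∷_; _++_; replicate; length; allFin)
  import Data.List.Properties as List
  open import Data.Product using (∃; _×_; _,_; proj₁; proj₂)
  open import Data.Vec.Functional as Vector using (Vector; updateAt; toList)
  open import Data.Vec.Functional.Properties using (updateAt-updates; updateAt-minimal; updateAt-updateAt; updateAt-id)
  open import Function using (_∘_; mk⇔)
  open import Relation.Nullary using (yes; no)
  open import Relation.Binary.PropositionalEquality as ≡ using (_≡_; _≢_; _≗_)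

  open FiniteField F using (size; 0#)
  open Enumeration F
  open NonzeroElements F using (K; α)
  open WordClasses F D′

  words : ∀ n → List (Vector (Fin size) n)
  words n = allFuns n size

  classes : List Class
  classes = allFuns K D

  count : ℕ → Class → ℕ
  count n c = ∑ (words n) (λ v → 𝟙 (classOf v ≗? c))

  count-invariant : ∀ n → ≗-Invariant (count n)
  count-invariant n c≗c′ = ∑-cong (words n) (λ v → 𝟙-cong (classOf v ≗? _) (classOf v ≗? _)
    (mk⇔ (λ v≗c j → ≡.trans (v≗c j) (c≗c′ j)) (λ v≗c′ j → ≡.trans (v≗c′ j) (≡.sym (c≗c′ j)))))

  count-suc : ∀ n c → count (suc n) c ≡ ∑ (allFin size) (λ i → count n (retreat i c))
  count-suc n c = ≡.trans (∑-allFuns-suc n size _) (∑-cong (allFin size) (λ i → ∑-cong (words n) (λ v →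
    𝟙-cong (advance i (classOf v) ≗? c) (classOf v ≗? retreat i c)
      (mk⇔ (advance-≗⇒≗-retreat i (classOf v) c) (≗-retreat⇒advance-≗ i (classOf v) c)))))

  walkL : List (Fin size) → Class → Class
  walkL []      c = c
  walkL (i ∷ w) c = walkL w (retreat i c)

  walk : ∀ {m} → Vector (Fin size) m → Class → Class
  walk w = walkL (toList w)

  count-+ : ∀ m n c → count (m + n) c ≡ ∑ (words m) (λ w → count n (walk w c))
  count-+ zero    n c = ≡.sym (ℕ.+-identityʳ _)
  count-+ (suc m) n c = ≡.trans (count-suc (m + n) c) (≡.trans
    (∑-cong (allFin size) (λ i → count-+ m n (retreat i c)))
    (≡.sym (∑-allFuns-suc m size (λ w → count n (walk w c)))))

  paths : ℕ → Class → Class → ℕ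
  paths m c g = ∑ (words m) (λ w → 𝟙 (walk w c ≗? g))

  count-+-paths : ∀ m n c → count (m + n) c ≡ ∑ classes (λ g → paths m c g * count n g)
  count-+-paths m n c = ≡.trans (count-+ m n c) (∑-fibres (words m) (λ w → walk w c) (count n) (count-invariant n))

  ∑-fibres-one : ∀ {m} (κ : Vector (Fin size) m → Class) → ∑ classes (λ g → ∑ (words m) (λ v → 𝟙 (κ v ≗? g))) ≡ size ^ m
  ∑-fibres-one {m} κ = begin
    ∑ classes (λ g → ∑ (words m) (λ v → 𝟙 (κ v ≗? g)))     ≡⟨ ∑-cong classes (λ g → ℕ.*-identityʳ _) ⟨
    ∑ classes (λ g → ∑ (words m) (λ v → 𝟙 (κ v ≗? g)) * 1) ≡⟨ ∑-fibres (words m) κ (λ _ → 1) (λ _ → ≡.refl) ⟨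
    ∑ (words m) (λ _ → 1)                                   ≡⟨ ∑-one (words m) ⟩
    length (words m)                                        ≡⟨ length-allFuns m size ⟩
    size ^ m                                                ∎
    where open ≡.≡-Reasoning

  ∑-count : ∀ n → ∑ classes (count n) ≡ size ^ n
  ∑-count n = ∑-fibres-one {n} classOf

  ∑-paths : ∀ m c → ∑ classes (paths m c) ≡ size ^ m
  ∑-paths m c = ∑-fibres-one {m} (λ w → walk w c)

  walkL-++ : ∀ w u c → walkL (w ++ u) c ≡ walkL u (walkL w c)
  walkL-++ []      u c = ≡.refl
  walkL-++ (i ∷ w) u c = walkL-++ w u (retreat i c)

  walkL-replicate-α : ∀ j s c → walkL (replicate s (index (α j))) c ≗ updateAt c j (cycPred^ s)
  walkL-replicate-α j zero    c j′ = ≡.sym (updateAt-id {n = K} j c j′)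
  walkL-replicate-α j (suc s) c j′ = begin
    walkL (replicate s (index (α j))) (retreat (index (α j)) c) j′
      ≡⟨ ≡.cong (λ c′ → walkL (replicate s (index (α j))) c′ j′) (retreat-α j c) ⟩
    walkL (replicate s (index (α j))) (updateAt c j cycPred) j′
      ≡⟨ walkL-replicate-α j s (updateAt c j cycPred) j′ ⟩
    updateAt (updateAt c j cycPred) j (cycPred^ s) j′
      ≡⟨ updateAt-updateAt {n = K} j {f = cycPred^ s} {g = cycPred} c j′ ⟩
    updateAt c j (cycPred^ (suc s)) j′ ∎
    where open ≡.≡-Reasoning

  steer : ∀ (c g : Class) t → t ≤ K →
    ∃ λ w → length w ≤ t * D′ × (∀ j → toℕ j < t → walkL w c j ≡ g j) × (∀ j → t ≤ toℕ j → walkL w c j ≡ c j)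
  steer c g zero    _   = [] , z≤n , (λ _ ()) , (λ _ _ → ≡.refl)
  steer c g (suc t) t<K with steer c g t (ℕ.<⇒≤ t<K)
  ... | w , |w|≤ , steered , untouched = w′ , |w′|≤ , steered′ , untouched′
    where
    jₜ : Fin K
    jₜ = fromℕ< t<K
    toℕ-jₜ : toℕ jₜ ≡ t
    toℕ-jₜ = Fin.toℕ-fromℕ< t<K
    reaches : ∃ λ s → s ≤ D′ × cycPred^ s (walkL w c jₜ) ≡ g jₜ
    reaches = cycPred^-reaches (walkL w c jₜ) (g jₜ)
    s : ℕ
    s = proj₁ reaches
    w′ : List (Fin size)
    w′ = w ++ replicate s (index (α jₜ))
    after : ∀ j → walkL w′ c j ≡ updateAt (walkL w c) jₜ (cycPred^ s) j
    after j = ≡.trans (≡.cong (λ c′ → c′ j) (walkL-++ w _ c)) (walkL-replicate-α jₜ s (walkL w c) j)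
    unchanged : ∀ j → toℕ j ≢ t → walkL w′ c j ≡ walkL w c j
    unchanged j j≢t = ≡.trans (after j)
      (updateAt-minimal j jₜ {f = cycPred^ s} (walkL w c) (λ j≡jₜ → j≢t (≡.trans (≡.cong toℕ j≡jₜ) toℕ-jₜ)))
    |w′|≤ : length w′ ≤ suc t * D′
    |w′|≤ = ≡.subst₂ _≤_ (≡.sym (≡.trans (List.length-++ w) (≡.cong (length w +_) (List.length-replicate s))))
      (ℕ.+-comm (t * D′) D′) (ℕ.+-mono-≤ |w|≤ (proj₁ (proj₂ reaches)))
    steered′ : ∀ j → toℕ j < suc t → walkL w′ c j ≡ g j
    steered′ j j<1+t with toℕ j ℕ.≟ t
    ... | yes j≡t = ≡.subst (λ j → walkL w′ c j ≡ g j) (Fin.toℕ-injective (≡.trans toℕ-jₜ (≡.sym j≡t)))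
                      (≡.trans (after jₜ) (≡.trans (updateAt-updates jₜ {f = cycPred^ s} (walkL w c)) (proj₂ (proj₂ reaches))))
    ... | no  j≢t = ≡.trans (unchanged j j≢t) (steered j (ℕ.≤∧≢⇒< (ℕ.≤-pred j<1+t) j≢t))
    untouched′ : ∀ j → suc t ≤ toℕ j → walkL w′ c j ≡ c j
    untouched′ j t<j = ≡.trans (unchanged j (λ j≡t → ℕ.<-irrefl (≡.sym j≡t) t<j)) (untouched j (ℕ.<⇒≤ t<j))

  padTo : ∀ n → List (Fin size) → Vector (Fin size) n
  padTo zero    _       = λ ()
  padTo (suc n) []      = index 0# Vector.∷ padTo n []
  padTo (suc n) (i ∷ w) = i Vector.∷ padTo n w

  walk-padTo : ∀ n w c → length w ≤ n → walk (padTo n w) c ≡ walkL w c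
  walk-padTo zero    []      c _         = ≡.refl
  walk-padTo (suc n) []      c _         = ≡.trans (≡.cong (walk (padTo n [])) (retreat-0 c)) (walk-padTo n [] c z≤n)
  walk-padTo (suc n) (i ∷ w) c (s≤s |w|≤n) = walk-padTo n w (retreat i c) |w|≤n

  -- Every class reaches every other in at most K · D′ steps; the extra step makes T nonzero.
  T : ℕ
  T = suc (K * D′)

  reach : ∀ c g → ∃ λ (w : Vector (Fin size) T) → walk w c ≗ g
  reach c g with steer c g K ℕ.≤-refl
  ... | w , |w|≤ , steered , _ = padTo T w , λ j →
    ≡.trans (≡.cong (λ c′ → c′ j) (walk-padTo T w c (ℕ.m≤n⇒m≤1+n |w|≤))) (steered j (Fin.toℕ<n j))

  paths-positive : ∀ c g → 1 ≤ paths T c g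
  paths-positive c g = ∑𝟙-positive T size (λ w → walk w c ≗? g)
    (λ w≗w′ walk≗g j → ≡.trans (≡.cong (λ u → walkL u c j) (List.tabulate-cong (≡.sym ∘ w≗w′))) (walk≗g j))
    {proj₁ (reach c g)} (proj₂ (reach c g))

module Doeblin where
  open Sums
  open import Data.Nat
  open import Data.Nat.Properties
  open import Data.List using (List; length)
  open import Data.Product using (_×_; _,_)
  open import Data.Nat.Tactic.RingSolver using (solve-∀)
  open import Relation.Binary.PropositionalEquality
  open import Algebra.Properties.CommutativeSemigroup *-commutativeSemigroup using (x∙yz≈y∙xz)

  module _ {G : Set} (gs : List G) (h : G → ℕ) (Q d : ℕ)
           (∑h≡Q : ∑ gs h ≡ Q) (Q≤ : ∀ g → Q ≤ length gs * h g + d) where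

    private
      N : ℕ
      N = length gs

    ∑-weighted-lower : ∀ (w : G → ℕ) → ∑ gs w * Q ≤ N * ∑ gs (λ g → h g * w g) + ∑ gs w * d
    ∑-weighted-lower w = begin
      ∑ gs w * Q                                      ≡⟨ trans (*-comm (∑ gs w) Q) (sym (∑-distribˡ-* gs Q w)) ⟩
      ∑ gs (λ g → Q * w g)                            ≤⟨ ∑-mono-≤ gs (λ g → *-monoˡ-≤ (w g) (Q≤ g)) ⟩
      ∑ gs (λ g → (N * h g + d) * w g)                ≡⟨ ∑-cong gs (λ g → expand (h g) (w g)) ⟩
      ∑ gs (λ g → N * (h g * w g) + d * w g)          ≡⟨ ∑-distrib-+ gs _ _ ⟩
      ∑ gs (λ g → N * (h g * w g)) + ∑ gs (λ g → d * w g)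
                                                      ≡⟨ cong₂ _+_ (∑-distribˡ-* gs N _) (trans (∑-distribˡ-* gs d w) (*-comm d _)) ⟩
      N * ∑ gs (λ g → h g * w g) + ∑ gs w * d         ∎
      where
      open ≤-Reasoning
      expand : ∀ x y → (N * x + d) * y ≡ N * (x * y) + d * y
      expand x y = trans (*-distribʳ-+ y (N * x) d) (cong (_+ d * y) (*-assoc N x y))

    -- Writing cnt g = 1 + c′ g, the constant part contributes exactly N · Q.
    doeblin-step : ∀ (cnt : G → ℕ) → (∀ g → 1 ≤ cnt g) →
      ∑ gs cnt * Q ≤ N * ∑ gs (λ g → cnt g * h g) + (∑ gs cnt ∸ N) * d
    doeblin-step cnt cnt≥1 = begin
      ∑ gs cnt * Q                              ≡⟨ cong (_* Q) ∑cnt≡N+C ⟩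
      (N + C) * Q                               ≡⟨ *-distribʳ-+ Q N C ⟩
      N * Q + C * Q                             ≤⟨ +-monoʳ-≤ (N * Q) (∑-weighted-lower c′) ⟩
      N * Q + (N * ∑ gs (λ g → h g * c′ g) + C * d)
                                                ≡⟨ regroup N Q (∑ gs (λ g → h g * c′ g)) (C * d) ⟩
      N * (Q + ∑ gs (λ g → h g * c′ g)) + C * d ≡⟨ cong₂ (λ u v → N * u + v * d) (sym ∑cnt*h) (sym (∑cnt∸N≡C)) ⟩
      N * ∑ gs (λ g → cnt g * h g) + (∑ gs cnt ∸ N) * d ∎
      where
      open ≤-Reasoning
      c′ : G → ℕ
      c′ g = cnt g ∸ 1
      cnt≡1+c′ : ∀ g → cnt g ≡ 1 + c′ g
      cnt≡1+c′ g = sym (m+[n∸m]≡n (cnt≥1 g))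
      C : ℕ
      C = ∑ gs c′
      ∑cnt≡N+C : ∑ gs cnt ≡ N + C
      ∑cnt≡N+C = trans (∑-cong gs cnt≡1+c′) (trans (∑-distrib-+ gs (λ _ → 1) c′) (cong (_+ C) (∑-one gs)))
      ∑cnt∸N≡C : ∑ gs cnt ∸ N ≡ C
      ∑cnt∸N≡C = trans (cong (_∸ N) ∑cnt≡N+C) (m+n∸m≡n N C)
      ∑cnt*h : ∑ gs (λ g → cnt g * h g) ≡ Q + ∑ gs (λ g → h g * c′ g)
      ∑cnt*h = trans (∑-cong gs (λ g → trans (cong (_* h g) (cnt≡1+c′ g)) (cong (h g +_) (*-comm (c′ g) (h g)))))
        (trans (∑-distrib-+ gs h _) (cong (_+ ∑ gs (λ g → h g * c′ g)) ∑h≡Q))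
      regroup : ∀ N Q S e → N * Q + (N * S + e) ≡ N * (Q + S) + e
      regroup = solve-∀

    ∑-indicator-bounds : ∀ (f f̄ : G → ℕ) → (∀ g → f g + f̄ g ≡ 1) →
      ∑ gs f * Q ≤ N * ∑ gs (λ g → h g * f g) + N * d × N * ∑ gs (λ g → h g * f g) ≤ ∑ gs f * Q + N * d
    ∑-indicator-bounds f f̄ f+f̄≡1 = lower , upper
      where
      open ≤-Reasoning
      a b A Ā : ℕ
      a = ∑ gs f
      b = ∑ gs f̄
      A = ∑ gs (λ g → h g * f g)
      Ā = ∑ gs (λ g → h g * f̄ g)
      a+b≡N : a + b ≡ N
      a+b≡N = trans (sym (∑-distrib-+ gs f f̄)) (trans (∑-cong gs f+f̄≡1) (∑-one gs))
      A+Ā≡Q : A + Ā ≡ Q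
      A+Ā≡Q = trans (sym (∑-distrib-+ gs _ _))
        (trans (∑-cong gs (λ g → trans (sym (*-distribˡ-+ (h g) (f g) (f̄ g))) (trans (cong (h g *_) (f+f̄≡1 g)) (*-identityʳ (h g)))))
               ∑h≡Q)
      lower : a * Q ≤ N * A + N * d
      lower = ≤-trans (∑-weighted-lower f) (+-monoʳ-≤ (N * A) (*-monoˡ-≤ d (subst (a ≤_) a+b≡N (m≤m+n a b))))
      -- The lower bound for the complement f̄, with the common term b * Q then cancelled.
      upper+bQ : N * A + b * Q ≤ (a * Q + b * d) + b * Q
      upper+bQ = begin
        N * A + b * Q               ≤⟨ +-monoʳ-≤ (N * A) (∑-weighted-lower f̄) ⟩
        N * A + (N * Ā + b * d)     ≡⟨ sym (+-assoc (N * A) _ _) ⟩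
        N * A + N * Ā + b * d       ≡⟨ cong (_+ b * d) (trans (sym (*-distribˡ-+ N A Ā)) (cong (N *_) A+Ā≡Q)) ⟩
        N * Q + b * d               ≡⟨ cong (λ n → n * Q + b * d) (sym a+b≡N) ⟩
        (a + b) * Q + b * d         ≡⟨ regroup a b Q d ⟩
        (a * Q + b * d) + b * Q     ∎
        where
        regroup : ∀ a b Q d → (a + b) * Q + b * d ≡ (a * Q + b * d) + b * Q
        regroup = solve-∀
      upper : N * A ≤ a * Q + N * d
      upper = ≤-trans (+-cancelʳ-≤ (b * Q) (N * A) _ upper+bQ)
        (+-monoʳ-≤ (a * Q) (*-monoˡ-≤ d (subst (b ≤_) a+b≡N (m≤n+m b a))))

  module Minorization {G : Set} (gs : List G) (q T : ℕ) (count : ℕ → G → ℕ) (paths : G → G → ℕ)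
    (count-T+ : ∀ n c → count (T + n) c ≡ ∑ gs (λ g → paths c g * count n g))
    (∑-count : ∀ n → ∑ gs (count n) ≡ q ^ n)
    (∑-paths : ∀ c → ∑ gs (paths c) ≡ q ^ T)
    (paths-positive : ∀ c g → 1 ≤ paths c g)
    where

    N : ℕ
    N = length gs

    B : ℕ
    B = q ^ T ∸ N

    count-lower : ∀ j s c → q ^ (s + j * T) ≤ N * count (s + j * T) c + q ^ s * B ^ j
    count-lower zero    s c = subst₂ (λ n e → q ^ n ≤ N * count n c + e) (sym (+-identityʳ s)) (sym (*-identityʳ (q ^ s)))
      (m≤n+m (q ^ s) _)
    count-lower (suc j) s c = subst (λ n → q ^ n ≤ N * count n c + q ^ s * B ^ suc j) (sym (shuffle s j T)) (begin
      q ^ (T + n)                                    ≡⟨ ^-distribˡ-+-* q T n ⟩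
      q ^ T * q ^ n                                  ≡⟨ cong (_* q ^ n) (sym (∑-paths c)) ⟩
      ∑ gs (paths c) * q ^ n                         ≤⟨ doeblin-step gs (count n) (q ^ n) e (∑-count n) (λ g → count-lower j s g)
                                                                     (paths c) (paths-positive c) ⟩
      N * ∑ gs (λ g → paths c g * count n g) + (∑ gs (paths c) ∸ N) * e
                                                     ≡⟨ cong₂ (λ u v → N * u + (v ∸ N) * e) (sym (count-T+ n c)) (∑-paths c) ⟩
      N * count (T + n) c + B * (q ^ s * B ^ j)      ≡⟨ cong (N * count (T + n) c +_) (x∙yz≈y∙xz B (q ^ s) (B ^ j)) ⟩
      N * count (T + n) c + q ^ s * B ^ suc j        ∎)
      where
      open ≤-Reasoning
      n e : ℕ
      n = s + j * T
      e = q ^ s * B ^ j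
      shuffle : ∀ s j T → s + (T + j * T) ≡ T + (s + j * T)
      shuffle = solve-∀

module Geometric where
  open import Data.Nat
  open import Data.Nat.Properties
  open import Data.Nat.Tactic.RingSolver using (solve-∀)
  open import Relation.Binary.PropositionalEquality

  bernoulli : ∀ b j → b ^ j * (b + j) ≤ b * suc b ^ j
  bernoulli b zero    = ≤-reflexive (trans (+-identityʳ (b + 0)) (trans (+-identityʳ b) (sym (*-identityʳ b))))
  bernoulli b (suc j) = begin
    b * b ^ j * (b + suc j)              ≡⟨ expand b (b ^ j) j ⟩
    b * (b ^ j * (b + j)) + b * b ^ j    ≤⟨ +-mono-≤ (*-monoʳ-≤ b (bernoulli b j)) (*-monoʳ-≤ b (^-monoˡ-≤ j (n≤1+n b))) ⟩
    b * (b * suc b ^ j) + b * suc b ^ j  ≡⟨ collect b (suc b ^ j) ⟩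
    b * (suc b * suc b ^ j)              ∎
    where
    open ≤-Reasoning
    expand : ∀ b x j → b * x * (b + suc j) ≡ b * (x * (b + j)) + b * x
    expand = solve-∀
    collect : ∀ b y → b * (b * y) + b * y ≡ b * (suc b * y)
    collect = solve-∀

  -- By Bernoulli, (1 + 1/b) ^ j ≥ 1 + j/b, which exceeds k once j > k b.
  geometric-small : ∀ a b k m j → b < a → 1 ≤ m → k * b + 1 ≤ j → b ^ j * k < m * a ^ j
  geometric-small a zero    k m zero    _   _   k*0+1≤0 with () ← ≤-trans (m≤n+m 1 (k * zero)) k*0+1≤0
  geometric-small a zero    k m (suc j) 0<a 1≤m _       = *-mono-≤ 1≤m (m^n>0 a (suc j))
    where instance _ = >-nonZero 0<a
  geometric-small a (suc b′) k m j b<a 1≤m j≥ = *-cancelˡ-< b _ _ (begin-strict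
    b * (b ^ j * k)    ≡⟨ x∙yz≈y∙xz b (b ^ j) k ⟩
    b ^ j * (b * k)    <⟨ *-monoʳ-< (b ^ j) {{m^n≢0 b j}} b*k<b+j ⟩
    b ^ j * (b + j)    ≤⟨ bernoulli b j ⟩
    b * suc b ^ j      ≤⟨ *-monoʳ-≤ b (^-monoˡ-≤ j b<a) ⟩
    b * a ^ j          ≤⟨ *-monoʳ-≤ b (≤-trans (≤-reflexive (sym (*-identityˡ (a ^ j)))) (*-monoˡ-≤ (a ^ j) 1≤m)) ⟩
    b * (m * a ^ j)    ∎)
    where
    open ≤-Reasoning
    open import Algebra.Properties.CommutativeSemigroup *-commutativeSemigroup using (x∙yz≈y∙xz)
    b : ℕ
    b = suc b′
    b*k<b+j : b * k < b + j
    b*k<b+j = begin-strict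
      b * k    ≡⟨ *-comm b k ⟩
      k * b    <⟨ subst (_≤ j) (+-comm (k * b) 1) j≥ ⟩
      j        ≤⟨ m≤n+m j b ⟩
      b + j    ∎

module Rational where
  open import Data.Nat as ℕ using (ℕ; zero; suc; _≤_; _<_)
  import Data.Nat.Properties as ℕ
  open import Data.Integer as ℤ using (ℤ; +_; -[1+_]; _⊖_)
  import Data.Integer.Properties as ℤ
  open import Data.Rational as ℚ using (ℚ; mkℚ; 0ℚ; ∣_∣; _-_; toℚᵘ; ↥_; ↧ₙ_)
  import Data.Rational.Properties as ℚ
  open import Data.Rational.Unnormalised as ℚᵘ using (mkℚᵘ; *<*)
  import Data.Rational.Unnormalised.Properties as ℚᵘ
  open import Data.Nat.Tactic.RingSolver using (solve-∀)
  open import Relation.Nullary using (yes; no)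
  open import Relation.Binary.PropositionalEquality

  ∣⊖∣≤ : ∀ u v e → u ≤ v ℕ.+ e → v ≤ u ℕ.+ e → ℤ.∣ u ⊖ v ∣ ≤ e
  ∣⊖∣≤ u v e u≤v+e v≤u+e with u ℕ.≤? v
  ... | yes u≤v = subst (_≤ e) (sym (ℤ.∣⊖∣-≤ u≤v)) (ℕ.m≤n+o⇒m∸n≤o v u v≤u+e)
  ... | no  u≰v = subst (_≤ e) (sym (trans (ℤ.∣m⊖n∣≡∣n⊖m∣ u v) (ℤ.∣⊖∣-≤ (ℕ.<⇒≤ (ℕ.≰⇒> u≰v)))))
                    (ℕ.m≤n+o⇒m∸n≤o u v u≤v+e)

  -- The hypotheses are |X/Q − a/N| ≤ d/Q and d/Q < ε, cross-multiplied.
  frac-close : ∀ X a Q N d (ε : ℚ) → 1 ≤ Q → 1 ≤ N → 0ℚ ℚ.< ε →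
    N ℕ.* X ≤ a ℕ.* Q ℕ.+ N ℕ.* d → a ℕ.* Q ≤ N ℕ.* X ℕ.+ N ℕ.* d → d ℕ.* ↧ₙ ε < ℤ.∣ ↥ ε ∣ ℕ.* Q →
    ∣ frac X Q - frac a N ∣ ℚ.< ε
  frac-close X a (suc Q′) (suc N′) d (mkℚ (+ zero) _ _) _ _ 0<ε with ℚ.toℚᵘ-mono-< 0<ε
  ... | *<* (ℤ.+<+ ())
  frac-close X a (suc Q′) (suc N′) d (mkℚ -[1+ _ ] _ _) _ _ 0<ε with ℚ.toℚᵘ-mono-< 0<ε
  ... | *<* ()
  frac-close X a Q@(suc Q′) N@(suc N′) d ε@(mkℚ (+ suc m) dₑ _) _ _ _ NX≤ aQ≤ dδ<mQ =
    ℚ.toℚᵘ-cancel-< (ℚᵘ.<-respˡ-≃ (ℚᵘ.≃-sym toℚᵘ-distance) (*<* (subst₂ ℤ._<_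
      (trans (ℤ.pos-* ℤ.∣ (X ℕ.* N) ⊖ (a ℕ.* Q) ∣ (suc dₑ)) (cong (λ z → + ℤ.∣ z ∣ ℤ.* + suc dₑ) (sym numerator≡)))
      (ℤ.pos-* (suc m) (Q ℕ.* N)) (ℤ.+<+ numerators))))
    where
    distanceᵘ : ℚᵘ.ℚᵘ
    distanceᵘ = ℚᵘ.∣ mkℚᵘ (+ X) Q′ ℚᵘ.+ ℚᵘ.- mkℚᵘ (+ a) N′ ∣
    toℚᵘ-distance : toℚᵘ ∣ frac X Q - frac a N ∣ ℚᵘ.≃ distanceᵘ
    toℚᵘ-distance = ℚᵘ.≃-trans (ℚ.toℚᵘ-homo-∣-∣ (frac X Q - frac a N)) (ℚᵘ.∣-∣-cong (ℚᵘ.≃-trans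
      (ℚ.toℚᵘ-homo-+ (frac X Q) (ℚ.- frac a N))
      (ℚᵘ.+-cong (ℚ.toℚᵘ-fromℚᵘ (mkℚᵘ (+ X) Q′))
                 (ℚᵘ.≃-trans (ℚ.toℚᵘ-homo‿- (frac a N)) (ℚᵘ.-‿cong (ℚ.toℚᵘ-fromℚᵘ (mkℚᵘ (+ a) N′)))))))
    numerator≡ : + X ℤ.* + N ℤ.+ (ℤ.- (+ a)) ℤ.* + Q ≡ (X ℕ.* N) ⊖ (a ℕ.* Q)
    numerator≡ = trans (cong₂ ℤ._+_ (sym (ℤ.pos-* X N))
      (trans (sym (ℤ.neg-distribˡ-* (+ a) (+ Q))) (cong ℤ.-_ (sym (ℤ.pos-* a Q))))) (ℤ.m-n≡m⊖n (X ℕ.* N) (a ℕ.* Q))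
    ∣XN-aQ∣≤Nd : ℤ.∣ (X ℕ.* N) ⊖ (a ℕ.* Q) ∣ ≤ N ℕ.* d
    ∣XN-aQ∣≤Nd = ∣⊖∣≤ _ _ (N ℕ.* d) (subst (_≤ a ℕ.* Q ℕ.+ N ℕ.* d) (ℕ.*-comm N X) NX≤)
                                   (subst (λ z → a ℕ.* Q ≤ z ℕ.+ N ℕ.* d) (ℕ.*-comm N X) aQ≤)
    numerators : ℤ.∣ (X ℕ.* N) ⊖ (a ℕ.* Q) ∣ ℕ.* suc dₑ < suc m ℕ.* (Q ℕ.* N)
    numerators = ℕ.≤-<-trans (ℕ.*-monoˡ-≤ (suc dₑ) ∣XN-aQ∣≤Nd)
      (subst₂ _<_ (reassocˡ N d (suc dₑ)) (reassocʳ N (suc m) Q) (ℕ.*-monoʳ-< N dδ<mQ))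
      where
      reassocˡ : ∀ N d δ → N ℕ.* (d ℕ.* δ) ≡ N ℕ.* d ℕ.* δ
      reassocˡ = solve-∀
      reassocʳ : ∀ N m Q → N ℕ.* (m ℕ.* Q) ≡ m ℕ.* (Q ℕ.* N)
      reassocʳ = solve-∀

  1≤∣↥ε∣ : ∀ {ε} → 0ℚ ℚ.< ε → 1 ≤ ℤ.∣ ↥ ε ∣
  1≤∣↥ε∣ {mkℚ (+ zero) _ _} 0<ε with ℚ.toℚᵘ-mono-< 0<ε
  ... | *<* (ℤ.+<+ ())
  1≤∣↥ε∣ {mkℚ -[1+ _ ] _ _} 0<ε with ℚ.toℚᵘ-mono-< 0<ε
  ... | *<* ()
  1≤∣↥ε∣ {mkℚ (+ suc _) _ _} _ = ℕ.s≤s ℕ.z≤n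

open Sums
open Doeblin
open Geometric
open Rational
open SymmetricPolynomials using (BinomialsVanish)
open Characteristic using (×-vanishes-on-multiples; p×1≈0; module Enumeration)
open PrimePowerBinomial using (p∣[p^s]Cj)
open import Data.Nat using (_≤_; _<_; _^_; _+_; _*_; _∸_)
import Data.Nat as ℕ
import Data.Nat.Properties as ℕ
open import Data.Nat.DivMod using (_/_; _%_; m≡m%n+[m/n]*n; /-monoˡ-≤; m*n/n≡m)
open import Data.Nat.Primality using (Prime)
import Data.Integer as ℤ
open import Data.Rational using (ℚ; 0ℚ; ∣_∣; _-_) renaming (_<_ to _<ℚ_)
open import Data.Rational using (↥_; ↧ₙ_)
open import Data.Fin using (toℕ)
import Data.Fin.Properties as Fin
open import Algebra.Properties.CommutativeSemigroup ℕ.*-commutativeSemigroup using (x∙yz≈y∙xz)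
open import Data.List using (filter; length)
open import Data.Product using (∃; _×_; _,_; proj₁; proj₂)
open import Data.Vec.Functional as Vector using ()
open import Function using (_∘_; mk⇔)
open import Relation.Nullary using (Dec; ¬?)
open import Relation.Binary.PropositionalEquality as ≡ using (_≡_)

binomials-vanish : ∀ F {p r} → Prime p → FiniteField.size F ≡ p ^ r → ∀ s → BinomialsVanish F (p ^ s)
binomials-vanish F {p} {r} p-prime size≡p^r s i x 0<i i<p^s =
  ×-vanishes-on-multiples (FiniteField.ring F) (p×1≈0 F p r size≡p^r) (p∣[p^s]Cj p-prime s i 0<i i<p^s) x

module Convergence (F : FiniteField) (D′ : ℕ) (vanish : BinomialsVanish F (ℕ.suc D′))
  (L : FiniteField.Carrier F → FiniteField.Carrier F) (L-cong : ∀ {x y} → FiniteField._≈_ F x y → FiniteField._≈_ F (L x) (L y))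
  (k : ℕ) (k<D : k < ℕ.suc D′) (β : FiniteField.Carrier F) where

  open FiniteField F using (_≈_; _≟_; 0#; size; enum; sym; trans)
  open Enumeration F using (index)
  open NonzeroElements F using (K; length-nonzeros)
  open WordClasses F D′
  open Counting F D′
  open Minorization classes size T count (paths T) (count-+-paths T) ∑-count (∑-paths T) paths-positive

  hits? : (c : Class) → Dec (L (Λ F k (toℕ ∘ c)) ≈ β)
  hits? c = L (Λ F k (toℕ ∘ c)) ≟ β

  hit : Class → ℕ
  hit = 𝟙 ∘ hits?

  hit-invariant : ≗-Invariant hit
  hit-invariant {c} {c′} c≗c′ =
    𝟙-cong (hits? c) (hits? c′) (mk⇔ (≡.subst (λ x → L x ≈ β) Λ≡) (≡.subst (λ x → L x ≈ β) (≡.sym Λ≡)))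
    where
    Λ≡ : Λ F k (toℕ ∘ c) ≡ Λ F k (toℕ ∘ c′)
    Λ≡ = ≡.cong (esym F k) (multiset-cong c≗c′)

  solutions : ℕ → ℕ
  solutions n = length (filter (λ v → L (esym F k (Vector.toList (λ j → enum (v j)))) ≟ β) (allFuns n size))

  solutions≡ : ∀ n → solutions n ≡ ∑ classes (λ g → count n g * hit g)
  solutions≡ n = ≡.trans (length-filter _ (words n)) (≡.trans
    (∑-cong (words n) (λ v → 𝟙-cong (L (esym F k (Vector.toList (enum ∘ v))) ≟ β) (hits? (classOf v))
      (mk⇔ (trans (L-cong (sym (esym-classOf vanish v k k<D)))) (trans (L-cong (esym-classOf vanish v k k<D))))))
    (∑-fibres (words n) classOf hit hit-invariant))

  limitHits : ℕ
  limitHits = length (filter (λ b → L (Λ F k (λ i → toℕ (b i))) ≟ β) (allFuns K D))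

  limitHits≡ : limitHits ≡ ∑ classes hit
  limitHits≡ = length-filter hits? classes

  N≡D^[q-1] : N ≡ D ^ (size ∸ 1)
  N≡D^[q-1] = ≡.trans (length-allFuns K D) (≡.cong (D ^_) length-nonzeros)

  1≤N : 1 ≤ N
  1≤N = ≡.subst (1 ≤_) (≡.sym (length-allFuns K D)) (ℕ.m^n>0 D K)

  instance
    size≢0 : ℕ.NonZero size
    size≢0 = ℕ.>-nonZero (ℕ.≤-trans (ℕ.s≤s ℕ.z≤n) (Fin.toℕ<n (index 0#)))

  B<size^T : B < size ^ T
  B<size^T = ∸-< (ℕ.m^n>0 size T) 1≤N
    where
    ∸-< : ∀ {a b} → 1 ≤ a → 1 ≤ b → a ∸ b < a
    ∸-< {ℕ.suc a} {ℕ.suc b} _ _ = ℕ.s≤s (ℕ.m∸n≤m a b)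

  sandwich : ∀ n s j → n ≡ s + j * T →
    (N * solutions n ≤ limitHits * size ^ n + N * (size ^ s * B ^ j)) ×
    (limitHits * size ^ n ≤ N * solutions n + N * (size ^ s * B ^ j))
  sandwich n s j n≡ with ∑-indicator-bounds classes (count n) (size ^ n) (size ^ s * B ^ j) (∑-count n)
                           (λ g → ≡.subst (λ n → size ^ n ≤ N * count n g + size ^ s * B ^ j) (≡.sym n≡) (count-lower j s g))
                           hit (𝟙 ∘ ¬? ∘ hits?) (𝟙+𝟙¬≡1 ∘ hits?)
  ... | lower , upper rewrite ≡.sym (solutions≡ n) | ≡.sym limitHits≡ = upper , lower

  prob-close : ∀ ε → 0ℚ <ℚ ε → ∀ n s j → n ≡ s + j * T → size ^ s * B ^ j * ↧ₙ ε < ℤ.∣ ↥ ε ∣ * size ^ n →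
    ∣ prob F L n k β - limitCoeff F L k D β ∣ <ℚ ε
  prob-close ε 0<ε n s j n≡ small = ≡.subst (λ M → ∣ prob F L n k β - frac limitHits M ∣ <ℚ ε) N≡D^[q-1]
    (frac-close (solutions n) limitHits (size ^ n) N (size ^ s * B ^ j) ε
      (ℕ.m^n>0 size n) 1≤N 0<ε (proj₁ (sandwich n s j n≡)) (proj₂ (sandwich n s j n≡)) small)

  error-small : ∀ ε → 0ℚ <ℚ ε → ∀ n → (↧ₙ ε * B + 1) * T ≤ n →
    size ^ (n % T) * B ^ (n / T) * ↧ₙ ε < ℤ.∣ ↥ ε ∣ * size ^ n
  error-small ε 0<ε n j₀T≤n = ≡.subst₂ _<_ (≡.sym (ℕ.*-assoc (size ^ s) (B ^ j) (↧ₙ ε)))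
    (≡.trans (x∙yz≈y∙xz (size ^ s) ℤ.∣ ↥ ε ∣ ((size ^ T) ^ j)) (≡.cong (ℤ.∣ ↥ ε ∣ *_) (≡.sym size^n≡)))
    (ℕ.*-monoʳ-< (size ^ s) {{ℕ.m^n≢0 size s}}
      (geometric-small (size ^ T) B (↧ₙ ε) ℤ.∣ ↥ ε ∣ j B<size^T (1≤∣↥ε∣ 0<ε)
        (≡.subst (_≤ j) (m*n/n≡m (↧ₙ ε * B + 1) T) (/-monoˡ-≤ T j₀T≤n))))
    where
    s j : ℕ
    s = n % T
    j = n / T
    size^n≡ : size ^ n ≡ size ^ s * (size ^ T) ^ j
    size^n≡ = ≡.trans (≡.cong (size ^_) (m≡m%n+[m/n]*n n T)) (≡.trans (ℕ.^-distribˡ-+-* size s (j * T))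
      (≡.cong (size ^ s *_) (≡.trans (≡.cong (size ^_) (ℕ.*-comm j T)) (≡.sym (ℕ.^-*-assoc size T j)))))

  convergence : ∀ ε → 0ℚ <ℚ ε → ∃ λ N → ∀ n → N ≤ n → ∣ prob F L n k β - limitCoeff F L k D β ∣ <ℚ ε
  convergence ε 0<ε = (↧ₙ ε * B + 1) * T , λ n N≤n →
    prob-close ε 0<ε n (n % T) (n / T) (m≡m%n+[m/n]*n n T) (error-small ε 0<ε n N≤n)

theorem3p1 : (F : FiniteField) (p r : ℕ) → Prime p → 1 ≤ r →
    FiniteField.size F ≡ p ^ r →
    (L : FiniteField.Carrier F → FiniteField.Carrier F) → IsLinear F L →
    (k : ℕ) → 1 < k →
    (m : ℕ) → p ^ m ≤ k → k < p ^ (m + 1) →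
    (D : ℕ) → D ≡ p ^ (m + 1) →
    ∀ (β : FiniteField.Carrier F) (ε : ℚ) → 0ℚ <ℚ ε →
      ∃ λ N → ∀ n → N ≤ n →
        ∣ prob F L n k β - limitCoeff F L k D β ∣ <ℚ ε
theorem3p1 F p r p-prime _ size≡p^r L L-linear k _ m _ k<p^[m+1] (ℕ.suc D′) D≡p^[m+1] β =
  Convergence.convergence F D′ vanish L (IsLinear.cong L-linear) k (≡.subst (k <_) (≡.sym D≡p^[m+1]) k<p^[m+1]) β
  where
  vanish : BinomialsVanish F (ℕ.suc D′)
  vanish = ≡.subst (BinomialsVanish F) (≡.sym D≡p^[m+1]) (binomials-vanish F {p} {r} p-prime size≡p^r (m + 1))
theorem3p1 F p r _ _ _ L _ k _ m _ k<p^[m+1] ℕ.zero 0≡p^[m+1] β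
  with () ← ≡.subst (k <_) (≡.sym 0≡p^[m+1]) k<p^[m+1]
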